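{- Let $G$ be a finite, simple, connected graph with diameter $d(G)$ and resolving number $\mathrm{res}(G)\geq 3$. If $G$ is not an even cycle, then $d(G)\leq 3\,\mathrm{res}(G)-5$.
   Context: $d(u,v)$ is the length of a shortest $u$-$v$ path and $d(G)=\max_{u,v}d(u,v)$. A vertex $w$ resolves a pair $\{x,y\}$ if $d(w,x)\neq d(w,y)$. A set $S\subseteq V(G)$ is a resolving set if every pair of vertices is resolved by some vertex of $S$. The resolving number $\mathrm{res}(G)$ is the minimum $k$ such that every $k$-subset of $V(G)$ is a resolving set. -}

module Defs where

open import Data.Nat using (ℕ; zero; suc; _≤_; _%_)
open import Data.Nat.Properties using ()
open import Data.Fin using (Fin; toℕ)
open import Data.Fin.Subset using (Subset; _∈_; ∣_∣)
open import Data.Product using (Σ; ∃; ∃-syntax; _×_)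
open import Data.Sum using (_⊎_)
open import Data.Empty using (⊥)
open import Relation.Nullary using (¬_)
open import Relation.Binary.PropositionalEquality using (_≡_; _≢_)
open import Function.Bundles using (_⇔_)
open import Function.Definitions using (Injective)

record Graph (n : ℕ) : Set₁ where
  field
    Adj   : Fin n → Fin n → Set
    irrefl : ∀ u → ¬ Adj u u
    sym    : ∀ u v → Adj u v → Adj v u
open Graph public

module _ {n : ℕ} (G : Graph n) where

  data Walk : Fin n → Fin n → ℕ → Set where
    here : ∀ {u} → Walk u u 0
    step : ∀ {u w v k} → Adj G u w → Walk w v k → Walk u v (suc k)

  -- d(u,v) = k : there is a u-v walk of length k and none shorter
  -- (a shortest walk is a shortest path)
  IsDist : Fin n → Fin n → ℕ → Set
  IsDist u v k = Walk u v k × (∀ m → Walk u v m → k ≤ m)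

  Connected : Set
  Connected = ∀ u v → ∃[ k ] Walk u v k

  IsDiameter : ℕ → Set
  IsDiameter D = (∀ u v k → IsDist u v k → k ≤ D) × (∃[ u ] ∃[ v ] IsDist u v D)

  Resolves : Fin n → Fin n → Fin n → Set
  Resolves w x y = ∀ k l → IsDist w x k → IsDist w y l → k ≢ l

  IsResolvingSet : Subset n → Set
  IsResolvingSet S = ∀ x y → x ≢ y → ∃[ w ] (w ∈ S × Resolves w x y)

  AllResolving : ℕ → Set
  AllResolving k = ∀ (S : Subset n) → ∣ S ∣ ≡ k → IsResolvingSet S

  IsResolvingNumber : ℕ → Set
  IsResolvingNumber r = AllResolving r × (∀ k → AllResolving k → r ≤ k)

CycleAdj : (n : ℕ) → Fin n → Fin n → Set
CycleAdj zero    i j = ⊥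
CycleAdj (suc m) i j = (suc (toℕ i) % suc m ≡ toℕ j) ⊎ (suc (toℕ j) % suc m ≡ toℕ i)

data Even : ℕ → Set where
  ev0  : Even 0
  ev+2 : ∀ {m} → Even m → Even (suc (suc m))

IsEvenCycle : {n : ℕ} → Graph n → Set
IsEvenCycle {n} G =
  3 ≤ n × Even n ×
  (∃[ f ] (Injective _≡_ _≡_ f × (∀ u v → Adj G u v ⇔ CycleAdj n (f u) (f v))))

module Submission where

-- When every r-set resolves, a pair of distinct vertices has fewer than r non-resolving vertices.
-- So it suffices to find a pair with at least (D + 2) / 3 non-resolving vertices, or to show that
-- every 2-set resolves (impossible as r ≥ 3), or that G is an even cycle.  For D ≤ 4 the bound
-- follows from r ≥ 3; otherwise take a geodesic v 0, …, v D of length D = d(G).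
-- * A vertex z off a geodesic, adjacent to an inner vertex v (1 + a), is seen from each v j as far as
--   one of v a, v (1 + a), v (2 + a), and from v (1 + a) as far as two of them; by pigeonhole one of
--   them forms with z the wanted pair (OffGeodesicNeighbour).
-- * Otherwise inner vertices have degree two, and the geodesic is grown at both ends into a strand
--   (Strands); prepending a vertex keeps the first D + 1 vertices a geodesic (Prepend), so a new end
--   vertex of degree three brings us back to the first case.  Growth stops at an end of the graph or
--   by closing a cycle: G is then a path or a cycle, where distances are those of the line or of the
--   cycle ℤ_L, and in a path or an odd cycle every 2-set resolves.
-- Adjacency is not assumed decidable; as the conclusion is decidable, it can be assumed by double negation.

open import Defs hiding (sym)
open import Data.Nat using (ℕ; zero; suc; _≤_; _<_; _+_; _*_; _∸_; z≤n; s≤s; pred; ∣_-_∣; _⊓_; _≟_; _≤?_)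
open import Data.Nat.Properties
open import Data.Nat.DivMod using (_%_; m<n⇒m%n≡m; n%n≡0)
open import Data.Nat.Solver using (module +-*-Solver)
open +-*-Solver using (solve; _:+_; _:*_; _:=_; con)
open import Data.Fin using (Fin; toℕ) renaming (_≟_ to _≟ᶠ_)
import Data.Fin as F
open import Data.Fin.Properties using (any?; injective⇒≤; toℕ-injective; toℕ<n; toℕ-fromℕ<)
  renaming (suc-injective to Fsuc-injective)
open import Data.Fin.Subset using (Subset; _∈_; ∣_∣; inside; outside)
import Data.Fin.Subset as Sub
open import Data.Fin.Subset.Properties using (∉⊥; ∣⊥∣≡0; Empty-unique; _∈?_)
open import Data.Vec using ([]; _∷_; here; there)
open import Data.Product using (∃; ∃-syntax; _×_; _,_; proj₁; proj₂)
open import Data.Sum using (_⊎_; inj₁; inj₂)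
open import Data.Empty using (⊥-elim)
open import Data.List using (List; []; _∷_; length; take)
open import Data.List.Properties using (length-take)
open import Data.List.Relation.Unary.All using (All; []; _∷_)
import Data.List.Relation.Unary.All as All
import Data.List.Relation.Unary.All.Properties as All
open import Data.List.Relation.Unary.AllPairs using ([]; _∷_)
open import Data.List.Relation.Unary.Unique.Propositional using (Unique)
import Data.List.Relation.Unary.Unique.Propositional.Properties as Unique
open import Relation.Nullary using (¬_; Dec; yes; no)
open import Relation.Nullary.Decidable using (decidable-stable; ¬¬-excluded-middle; _×-dec_; ¬?; map′)
open import Relation.Binary using (tri<; tri≈; tri>)
open import Relation.Binary.PropositionalEquality
  using (_≡_; _≢_; refl; sym; trans; cong; cong₂; subst; subst₂; module ≡-Reasoning)
open import Function.Bundles using (_⇔_; mk⇔; Equivalence)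

-- Arithmetic on the line.

∣-∣-gap : ∀ m k x → m + k ≡ x → ∣ m - x ∣ ≡ k × ∣ x - m ∣ ≡ k
∣-∣-gap m k _ refl = ∣m-m+n∣≡n m k , trans (∣-∣-comm (m + k) m) (∣m-m+n∣≡n m k)

double : ∀ m → m + m ≡ 2 * m
double m = cong (m +_) (sym (+-identityʳ m))

double-injective : ∀ m n → m + m ≡ n + n → m ≡ n
double-injective m n e = *-cancelˡ-≡ m n 2 (trans (sym (double m)) (trans e (double n)))

double≢odd : ∀ m k → m + m ≢ suc (k + k)
double≢odd m k e = even≢odd m k (trans (sym (double m)) (trans e (cong suc (double k))))

equidistant⇒midpoint : ∀ c x y → ∣ c - x ∣ ≡ ∣ c - y ∣ → x ≢ y → c + c ≡ x + y
equidistant⇒midpoint c x y e x≢y with ≤-total c x | ≤-total c y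
... | inj₁ c≤x | inj₁ c≤y with m≤n⇒∃[o]m+o≡n c≤x | m≤n⇒∃[o]m+o≡n c≤y
...   | p , refl | q , refl =
  ⊥-elim (x≢y (cong (c +_) (trans (sym (∣m-m+n∣≡n c p)) (trans e (∣m-m+n∣≡n c q)))))
equidistant⇒midpoint c x y e x≢y | inj₁ c≤x | inj₂ y≤c with m≤n⇒∃[o]m+o≡n c≤x | m≤n⇒∃[o]m+o≡n y≤c
...   | p , refl | q , refl with trans (sym (∣m-m+n∣≡n (y + q) p)) (trans e (proj₂ (∣-∣-gap y q _ refl)))
...     | refl = solve 2 (λ y p → (y :+ p) :+ (y :+ p) := ((y :+ p) :+ p) :+ y) refl y p
equidistant⇒midpoint c x y e x≢y | inj₂ x≤c | inj₁ c≤y with m≤n⇒∃[o]m+o≡n x≤c | m≤n⇒∃[o]m+o≡n c≤y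
...   | p , refl | q , refl with trans (sym (proj₂ (∣-∣-gap x p _ refl))) (trans e (∣m-m+n∣≡n (x + p) q))
...     | refl = solve 2 (λ x p → (x :+ p) :+ (x :+ p) := x :+ ((x :+ p) :+ p)) refl x p
equidistant⇒midpoint c x y e x≢y | inj₂ x≤c | inj₂ y≤c with m≤n⇒∃[o]m+o≡n x≤c | m≤n⇒∃[o]m+o≡n y≤c
...   | p , refl | q , x+p≡y+q with trans (sym (proj₂ (∣-∣-gap x p _ refl))) (trans e (proj₂ (∣-∣-gap y q _ x+p≡y+q)))
...     | refl = ⊥-elim (x≢y (sym (+-cancelʳ-≡ p y x x+p≡y+q)))

within-one : ∀ t φ → φ ≤ 2 + t → t ≤ φ → φ ≡ t ⊎ φ ≡ 1 + t ⊎ φ ≡ 2 + t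
within-one zero    zero                _           _         = inj₁ refl
within-one zero    (suc zero)          _           _         = inj₂ (inj₁ refl)
within-one zero    (suc (suc zero))    _           _         = inj₂ (inj₂ refl)
within-one zero    (suc (suc (suc φ))) (s≤s (s≤s ())) _
within-one (suc t) (suc φ)             (s≤s φ≤)    (s≤s t≤) with within-one t φ φ≤ t≤
... | inj₁ e        = inj₁ (cong suc e)
... | inj₂ (inj₁ e) = inj₂ (inj₁ (cong suc e))
... | inj₂ (inj₂ e) = inj₂ (inj₂ (cong suc e))

∣-∣≡1⇒consecutive : ∀ i j → ∣ i - j ∣ ≡ 1 → j ≡ suc i ⊎ i ≡ suc j
∣-∣≡1⇒consecutive zero          (suc zero)    _ = inj₁ refl
∣-∣≡1⇒consecutive (suc zero)    zero          _ = inj₂ refl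
∣-∣≡1⇒consecutive (suc i)       (suc j)       e with ∣-∣≡1⇒consecutive i j e
... | inj₁ x = inj₁ (cong suc x)
... | inj₂ y = inj₂ (cong suc y)
∣-∣≡1⇒consecutive zero          zero          ()
∣-∣≡1⇒consecutive zero          (suc (suc j)) ()
∣-∣≡1⇒consecutive (suc (suc i)) zero          ()

∣-∣-step : ∀ p j → ∣ p - j ∣ ≤ suc ∣ suc p - j ∣ × ∣ suc p - j ∣ ≤ suc ∣ p - j ∣
∣-∣-step p j =
  ≤-trans (∣-∣-triangle p (suc p) j) (+-monoˡ-≤ _ (≤-reflexive (proj₁ (∣-∣-gap p 1 (suc p) (+-comm p 1))))) ,
  ≤-trans (∣-∣-triangle (suc p) p j) (+-monoˡ-≤ _ (≤-reflexive (proj₂ (∣-∣-gap p 1 (suc p) (+-comm p 1)))))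

∸-unfold : ∀ K i → i < K → K ∸ i ≡ suc (K ∸ suc i)
∸-unfold K i i<K = +-∸-assoc 1 i<K

-- Reversing [0, K] exchanges the first window [0, D] and the last window [K ∸ D, K].
∸-window : ∀ K D a → D ≤ K → a ≤ D → K ∸ D + (D ∸ a) ≡ K ∸ a
∸-window K D a D≤K a≤D with m≤n⇒∃[o]m+o≡n D≤K
... | c , refl = begin
  D + c ∸ D + (D ∸ a) ≡⟨ cong (_+ (D ∸ a)) (m+n∸m≡n D c) ⟩
  c + (D ∸ a)         ≡⟨ +-comm c (D ∸ a) ⟩
  D ∸ a + c           ≡⟨ sym (+-∸-comm c a≤D) ⟩
  D + c ∸ a           ∎
  where open ≡-Reasoning

∸-window′ : ∀ K D a → D ≤ K → K ∸ (K ∸ D + a) ≡ D ∸ a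
∸-window′ K D a D≤K with m≤n⇒∃[o]m+o≡n D≤K
... | c , refl = begin
  D + c ∸ (D + c ∸ D + a) ≡⟨ cong (λ x → D + c ∸ (x + a)) (m+n∸m≡n D c) ⟩
  D + c ∸ (c + a)         ≡⟨ cong (_∸ (c + a)) (+-comm D c) ⟩
  c + D ∸ (c + a)         ≡⟨ [m+n]∸[m+o]≡n∸o c D a ⟩
  D ∸ a                   ∎
  where open ≡-Reasoning

∸-∸-cancel : ∀ D a b → a ≤ b → b ≤ D → D ∸ a ∸ (D ∸ b) ≡ b ∸ a
∸-∸-cancel _ a b a≤b b≤D with m≤n⇒∃[o]m+o≡n a≤b | m≤n⇒∃[o]m+o≡n b≤D
... | p , refl | c , refl = begin
  a + p + c ∸ a ∸ (a + p + c ∸ (a + p)) ≡⟨ cong₂ _∸_ (trans (cong (_∸ a) (+-assoc a p c)) (m+n∸m≡n a (p + c)))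
                                                      (m+n∸m≡n (a + p) c) ⟩
  p + c ∸ c                             ≡⟨ m+n∸n≡m p c ⟩
  p                                     ≡⟨ sym (m+n∸m≡n a p) ⟩
  a + p ∸ a                             ∎
  where open ≡-Reasoning

∣∸-∸∣ : ∀ D a b → a ≤ D → b ≤ D → ∣ D ∸ a - D ∸ b ∣ ≡ ∣ a - b ∣
∣∸-∸∣ D a b a≤D b≤D with ≤-total a b
... | inj₁ a≤b = begin
  ∣ D ∸ a - D ∸ b ∣ ≡⟨ m≤n⇒∣n-m∣≡n∸m (∸-monoʳ-≤ D a≤b) ⟩
  D ∸ a ∸ (D ∸ b)   ≡⟨ ∸-∸-cancel D a b a≤b b≤D ⟩
  b ∸ a             ≡⟨ sym (m≤n⇒∣m-n∣≡n∸m a≤b) ⟩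
  ∣ a - b ∣         ∎
  where open ≡-Reasoning
... | inj₂ b≤a = begin
  ∣ D ∸ a - D ∸ b ∣ ≡⟨ m≤n⇒∣m-n∣≡n∸m (∸-monoʳ-≤ D b≤a) ⟩
  D ∸ b ∸ (D ∸ a)   ≡⟨ ∸-∸-cancel D b a b≤a a≤D ⟩
  a ∸ b             ≡⟨ sym (m≤n⇒∣n-m∣≡n∸m b≤a) ⟩
  ∣ a - b ∣         ∎
  where open ≡-Reasoning

-- Arithmetic on the cycle of length L, whose points are 0, …, L ∸ 1.

cycDist : ℕ → ℕ → ℕ → ℕ
cycDist L p q = ∣ p - q ∣ ⊓ (L ∸ ∣ p - q ∣)

-- x ≡ c ± δ (mod L), written without subtraction.
Offset : ℕ → ℕ → ℕ → ℕ → Set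
Offset L c x δ = (x ≡ c + δ) ⊎ (x + δ ≡ c) ⊎ (x + L ≡ c + δ) ⊎ (x + δ ≡ c + L)

offset-min : ∀ L c x m → c + m ≡ x ⊎ x + m ≡ c → m ≤ L → Offset L c x (m ⊓ (L ∸ m))
offset-min L c x m h m≤L with ⊓-sel m (L ∸ m) | h
... | inj₁ e | inj₁ h′ = inj₁ (trans (sym h′) (cong (c +_) (sym e)))
... | inj₁ e | inj₂ h′ = inj₂ (inj₁ (trans (cong (x +_) e) h′))
... | inj₂ e | inj₁ refl = inj₂ (inj₂ (inj₂ (begin
  c + m + m ⊓ (L ∸ m) ≡⟨ cong (c + m +_) e ⟩
  c + m + (L ∸ m)     ≡⟨ +-assoc c m (L ∸ m) ⟩
  c + (m + (L ∸ m))   ≡⟨ cong (c +_) (m+[n∸m]≡n m≤L) ⟩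
  c + L               ∎)))
  where open ≡-Reasoning
... | inj₂ e | inj₂ refl = inj₂ (inj₂ (inj₁ (begin
  x + L               ≡⟨ cong (x +_) (sym (m+[n∸m]≡n m≤L)) ⟩
  x + (m + (L ∸ m))   ≡⟨ sym (+-assoc x m (L ∸ m)) ⟩
  x + m + (L ∸ m)     ≡⟨ cong (x + m +_) (sym e) ⟩
  x + m + m ⊓ (L ∸ m) ∎)))
  where open ≡-Reasoning

offset-cycDist : ∀ L c x → c < L → x < L → Offset L c x (cycDist L c x)
offset-cycDist L c x c<L x<L with ≤-total c x
... | inj₁ c≤x with m≤n⇒∃[o]m+o≡n c≤x
...   | m , refl = subst (λ k → Offset L c (c + m) (k ⊓ (L ∸ k))) (sym (∣m-m+n∣≡n c m))
                     (offset-min L c (c + m) m (inj₁ refl) (≤-trans (m≤n+m m c) (<⇒≤ x<L)))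
offset-cycDist L c x c<L x<L | inj₂ x≤c with m≤n⇒∃[o]m+o≡n x≤c
...   | m , refl = subst (λ k → Offset L (x + m) x (k ⊓ (L ∸ k))) (sym (proj₂ (∣-∣-gap x m _ refl)))
                     (offset-min L (x + m) x m (inj₂ refl) (≤-trans (m≤n+m m x) (<⇒≤ c<L)))

-- c is a midpoint of x and y: x + y ≡ 2c (mod L).
Midpoint : ℕ → ℕ → ℕ → ℕ → Set
Midpoint L c x y = (x + y ≡ c + c) ⊎ (x + y ≡ c + c + L) ⊎ (x + y + L ≡ c + c)

a+L≮L : ∀ {L} a → ¬ (a + L < L)
a+L≮L {L} a lt = <-irrefl refl (≤-trans (s≤s (m≤n+m L a)) lt)

offsets⇒midpoint : ∀ L c x y δ → x < L → y < L → x ≢ y →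
                   Offset L c x δ → Offset L c y δ → Midpoint L c x y
offsets⇒midpoint L c x y δ x<L y<L x≢y = go
  where
  go : Offset L c x δ → Offset L c y δ → Midpoint L c x y
  go (inj₁ refl) (inj₁ refl) = ⊥-elim (x≢y refl)
  go (inj₁ refl) (inj₂ (inj₁ refl)) = inj₁ (solve 2 (λ y δ → ((y :+ δ) :+ δ) :+ y := (y :+ δ) :+ (y :+ δ)) refl y δ)
  go (inj₁ refl) (inj₂ (inj₂ (inj₁ h))) = ⊥-elim (a+L≮L y (subst (_< L) (sym h) x<L))
  go (inj₁ refl) (inj₂ (inj₂ (inj₂ h))) = inj₂ (inj₁ (trans (solve 3 (λ c δ y → (c :+ δ) :+ y := c :+ (y :+ δ)) refl c δ y)
                                                        (trans (cong (c +_) h) (sym (+-assoc c c L)))))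
  go (inj₂ (inj₁ refl)) (inj₁ refl) = inj₁ (solve 2 (λ x δ → x :+ ((x :+ δ) :+ δ) := (x :+ δ) :+ (x :+ δ)) refl x δ)
  go (inj₂ (inj₁ refl)) (inj₂ (inj₁ h)) = ⊥-elim (x≢y (sym (+-cancelʳ-≡ δ y x h)))
  go (inj₂ (inj₁ refl)) (inj₂ (inj₂ (inj₁ h))) = inj₂ (inj₂ (trans (+-assoc x y L)
    (trans (cong (x +_) h) (solve 2 (λ x δ → x :+ ((x :+ δ) :+ δ) := (x :+ δ) :+ (x :+ δ)) refl x δ))))
  go (inj₂ (inj₁ refl)) (inj₂ (inj₂ (inj₂ h))) = ⊥-elim (a+L≮L x (subst (_< L) (+-cancelʳ-≡ δ y (x + L)
    (trans h (solve 3 (λ x δ L → (x :+ δ) :+ L := (x :+ L) :+ δ) refl x δ L))) y<L))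
  go (inj₂ (inj₂ (inj₁ h))) (inj₁ refl) = ⊥-elim (a+L≮L x (subst (_< L) (sym h) y<L))
  go (inj₂ (inj₂ (inj₁ h))) (inj₂ (inj₁ refl)) = inj₂ (inj₂ (trans (solve 3 (λ x y L → x :+ y :+ L := y :+ (x :+ L)) refl x y L)
    (trans (cong (y +_) h) (solve 2 (λ y δ → y :+ ((y :+ δ) :+ δ) := (y :+ δ) :+ (y :+ δ)) refl y δ))))
  go (inj₂ (inj₂ (inj₁ h))) (inj₂ (inj₂ (inj₁ h′))) = ⊥-elim (x≢y (+-cancelʳ-≡ L x y (trans h (sym h′))))
  go (inj₂ (inj₂ (inj₁ h))) (inj₂ (inj₂ (inj₂ h′))) = inj₁ (+-cancelʳ-≡ (L + δ) (x + y) (c + c)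
    (trans (solve 4 (λ x y L δ → (x :+ y) :+ (L :+ δ) := (x :+ L) :+ (y :+ δ)) refl x y L δ)
    (trans (cong₂ _+_ h h′) (solve 3 (λ c δ L → (c :+ δ) :+ (c :+ L) := (c :+ c) :+ (L :+ δ)) refl c δ L))))
  go (inj₂ (inj₂ (inj₂ h))) (inj₁ refl) = inj₂ (inj₁ (trans (solve 3 (λ x c δ → x :+ (c :+ δ) := c :+ (x :+ δ)) refl x c δ)
                                                        (trans (cong (c +_) h) (sym (+-assoc c c L)))))
  go (inj₂ (inj₂ (inj₂ h))) (inj₂ (inj₁ refl)) = ⊥-elim (a+L≮L y (subst (_< L) (+-cancelʳ-≡ δ x (y + L)
    (trans h (solve 3 (λ y δ L → (y :+ δ) :+ L := (y :+ L) :+ δ) refl y δ L))) x<L))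
  go (inj₂ (inj₂ (inj₂ h))) (inj₂ (inj₂ (inj₁ h′))) = inj₁ (+-cancelʳ-≡ (L + δ) (x + y) (c + c)
    (trans (solve 4 (λ x y L δ → (x :+ y) :+ (L :+ δ) := (x :+ δ) :+ (y :+ L)) refl x y L δ)
    (trans (cong₂ _+_ h h′) (solve 3 (λ c δ L → (c :+ L) :+ (c :+ δ) := (c :+ c) :+ (L :+ δ)) refl c δ L))))
  go (inj₂ (inj₂ (inj₂ h))) (inj₂ (inj₂ (inj₂ h′))) = ⊥-elim (x≢y (+-cancelʳ-≡ δ x y (trans h (sym h′))))

midpoint-unique : ∀ L t c e x y → L ≡ suc (t + t) → c < L → e < L →
                  Midpoint L c x y → Midpoint L e x y → c ≡ e
midpoint-unique L t c e x y L-odd c<L e<L = go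
  where
  2c≢2e+L : ∀ c e → c + c ≢ e + e + L
  2c≢2e+L c e h = double≢odd c (e + t) (trans h (trans (cong (e + e +_) L-odd)
    (solve 2 (λ e t → e :+ e :+ (con 1 :+ (t :+ t)) := con 1 :+ ((e :+ t) :+ (e :+ t))) refl e t)))
  2c+2L≢2e : ∀ c e → e < L → c + c + L + L ≢ e + e
  2c+2L≢2e c e e<L h = <-irrefl refl (≤-trans (+-mono-< e<L e<L)
    (≤-trans (m≤n+m (L + L) (c + c)) (≤-reflexive (trans (sym (+-assoc (c + c) L L)) h))))
  go : Midpoint L c x y → Midpoint L e x y → c ≡ e
  go (inj₁ p)        (inj₁ q)        = double-injective c e (trans (sym p) q)
  go (inj₁ p)        (inj₂ (inj₁ q)) = ⊥-elim (2c≢2e+L c e (trans (sym p) q))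
  go (inj₁ p)        (inj₂ (inj₂ q)) = ⊥-elim (2c≢2e+L e c (trans (sym q) (cong (_+ L) p)))
  go (inj₂ (inj₁ p)) (inj₁ q)        = ⊥-elim (2c≢2e+L e c (trans (sym q) p))
  go (inj₂ (inj₁ p)) (inj₂ (inj₁ q)) = double-injective c e (+-cancelʳ-≡ L (c + c) (e + e) (trans (sym p) q))
  go (inj₂ (inj₁ p)) (inj₂ (inj₂ q)) = ⊥-elim (2c+2L≢2e c e e<L (trans (cong (_+ L) (sym p)) q))
  go (inj₂ (inj₂ p)) (inj₁ q)        = ⊥-elim (2c≢2e+L c e (trans (sym p) (cong (_+ L) q)))
  go (inj₂ (inj₂ p)) (inj₂ (inj₁ q)) = ⊥-elim (2c+2L≢2e e c c<L (trans (cong (_+ L) (sym q)) p))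
  go (inj₂ (inj₂ p)) (inj₂ (inj₂ q)) = double-injective c e (trans (sym p) q)

odd-cycle-resolving : ∀ L t c e x y → L ≡ suc (t + t) → c < L → e < L → x < L → y < L → x ≢ y →
                      cycDist L c x ≡ cycDist L c y → cycDist L e x ≡ cycDist L e y → c ≡ e
odd-cycle-resolving L t c e x y L-odd c<L e<L x<L y<L x≢y c-eq e-eq = midpoint-unique L t c e x y L-odd c<L e<L
  (offsets⇒midpoint L c x y _ x<L y<L x≢y (offset-cycDist L c x c<L x<L)
    (subst (Offset L c y) (sym c-eq) (offset-cycDist L c y c<L y<L)))
  (offsets⇒midpoint L e x y _ x<L y<L x≢y (offset-cycDist L e x e<L x<L)
    (subst (Offset L e y) (sym e-eq) (offset-cycDist L e y e<L y<L)))

-- Cycle distances to a fixed point change by at most one along an edge of the cycle: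
-- first for two line distances x, x′ that differ by at most one …
min-distance-step : ∀ L x x′ → x ≤ suc x′ → x′ ≤ suc x → x′ ≤ L → x ⊓ (L ∸ x) ≤ suc (x′ ⊓ (L ∸ x′))
min-distance-step L x zero      x≤ _  _    = ⊓-mono-≤ x≤ (≤-trans (m∸n≤m L x) (n≤1+n L))
min-distance-step L x (suc x″) x≤ x′≤ x′≤L =
  ⊓-mono-≤ x≤ (≤-trans (∸-monoʳ-≤ L (≤-pred x′≤)) (≤-reflexive (∸-unfold L x″ x′≤L)))

cycDist-step : ∀ L p j → suc p < L → j < L →
               cycDist L p j ≤ suc (cycDist L (suc p) j) × cycDist L (suc p) j ≤ suc (cycDist L p j)
cycDist-step L p j p+1<L j<L =
  min-distance-step L _ _ (proj₁ (∣-∣-step p j)) (proj₂ (∣-∣-step p j)) (bounded (suc p) p+1<L) ,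
  min-distance-step L _ _ (proj₂ (∣-∣-step p j)) (proj₁ (∣-∣-step p j)) (bounded p (≤-trans (n≤1+n _) p+1<L))
  where
  bounded : ∀ q → q < L → ∣ q - j ∣ ≤ L
  bounded q q<L = ≤-trans (∣m-n∣≤m⊔n q j) (⊔-lub (<⇒≤ q<L) (<⇒≤ j<L))

-- … and along the closing edge K, 0 of the cycle of length K + 1.
cycDist-wrap : ∀ K j → j ≤ K → cycDist (suc K) K j ≤ suc (cycDist (suc K) 0 j) ×
                               cycDist (suc K) 0 j ≤ suc (cycDist (suc K) K j)
cycDist-wrap K j j≤K with m≤n⇒∃[o]m+o≡n j≤K
... | r , refl = subst₂ (λ a b → a ≤ suc b) (sym from-K) (sym from-0) (bound r j) ,
                 subst₂ (λ a b → a ≤ suc b) (sym from-0) (sym from-K) (bound j r)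
  where
  from-K : cycDist (suc (j + r)) (j + r) j ≡ r ⊓ suc j
  from-K = trans (cong (λ x → x ⊓ (suc (j + r) ∸ x)) (proj₂ (∣-∣-gap j r _ refl)))
                 (cong (r ⊓_) (m+n∸n≡m (suc j) r))
  from-0 : cycDist (suc (j + r)) 0 j ≡ j ⊓ suc r
  from-0 = cong (j ⊓_) (trans (cong (_∸ j) (sym (+-suc j r))) (m+n∸m≡n j (suc r)))
  bound : ∀ a b → a ⊓ suc b ≤ suc (b ⊓ suc a)
  bound a b = ≤-trans (⊓-mono-≤ (≤-trans (n≤1+n a) (n≤1+n (suc a))) (≤-refl {suc b}))
                      (≤-reflexive (⊓-comm (suc (suc a)) (suc b)))

pigeonhole₃ : ∀ M a b c → M ≤ a + b + c → M ≤ 3 * a ⊎ M ≤ 3 * b ⊎ M ≤ 3 * c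
pigeonhole₃ M a b c M≤ with M ≤? 3 * a | M ≤? 3 * b | M ≤? 3 * c
... | yes p | _     | _     = inj₁ p
... | no _  | yes p | _     = inj₂ (inj₁ p)
... | no _  | no _  | yes p = inj₂ (inj₂ p)
... | no ¬a | no ¬b | no ¬c = ⊥-elim (<-irrefl refl (begin-strict
  3 * (a + b + c)         ≡⟨ solve 3 (λ a b c → con 3 :* (a :+ b :+ c) := con 3 :* a :+ con 3 :* b :+ con 3 :* c) refl a b c ⟩
  3 * a + 3 * b + 3 * c   <⟨ +-mono-< (+-mono-< (≰⇒> ¬a) (≰⇒> ¬b)) (≰⇒> ¬c) ⟩
  M + M + M               ≡⟨ solve 1 (λ M → M :+ M :+ M := con 3 :* M) refl M ⟩
  3 * M                   ≤⟨ *-monoʳ-≤ 3 M≤ ⟩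
  3 * (a + b + c)         ∎))
  where open ≤-Reasoning

module Counting {P : ℕ → Set} (P? : ∀ j → Dec (P j)) where

  indicator : ℕ → ℕ
  indicator j with P? j
  ... | yes _ = 1
  ... | no  _ = 0

  indicator-yes : ∀ {j} → P j → indicator j ≡ 1
  indicator-yes {j} Pj with P? j
  ... | yes _  = refl
  ... | no ¬Pj = ⊥-elim (¬Pj Pj)

  count : ℕ → ℕ
  count zero    = 0
  count (suc N) = indicator N + count N

  selected : {A : Set} → (ℕ → A) → ℕ → List A
  selected f zero = []
  selected f (suc N) with P? N
  ... | yes _ = f N ∷ selected f N
  ... | no  _ = selected f N

  selected-length : ∀ {A : Set} (f : ℕ → A) N → length (selected f N) ≡ count N
  selected-length f zero = refl
  selected-length f (suc N) with P? N
  ... | yes _ = cong suc (selected-length f N)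
  ... | no  _ = selected-length f N

  private
    widen : ∀ {A : Set} {f : ℕ → A} {N w} → ∃[ j ] j < N × P j × w ≡ f j → ∃[ j ] j < suc N × P j × w ≡ f j
    widen (j , j<N , Pj , e) = j , m<n⇒m<1+n j<N , Pj , e

  selected-origin : ∀ {A : Set} (f : ℕ → A) N → All (λ w → ∃[ j ] j < N × P j × w ≡ f j) (selected f N)
  selected-origin f zero = []
  selected-origin f (suc N) with P? N
  ... | yes PN = (N , ≤-refl , PN , refl) ∷ All.map widen (selected-origin f N)
  ... | no  _  = All.map widen (selected-origin f N)

  selected-unique : ∀ {A : Set} (f : ℕ → A) N → (∀ i j → i < N → j < N → f i ≡ f j → i ≡ j) →
                    Unique (selected f N)
  selected-unique f zero    _   = []
  selected-unique f (suc N) inj with P? N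
  ... | yes _ = All.map (λ { (j , j<N , _ , e) fN≡w → <-irrefl (sym (inj N j ≤-refl (m<n⇒m<1+n j<N) (trans fN≡w e))) j<N })
                        (selected-origin f N)
              ∷ selected-unique f N (λ i j i<N j<N → inj i j (m<n⇒m<1+n i<N) (m<n⇒m<1+n j<N))
  ... | no  _ = selected-unique f N (λ i j i<N j<N → inj i j (m<n⇒m<1+n i<N) (m<n⇒m<1+n j<N))

module Cover {P Q R : ℕ → Set} (P? : ∀ j → Dec (P j)) (Q? : ∀ j → Dec (Q j)) (R? : ∀ j → Dec (R j)) where
  private
    module CP = Counting P?
    module CQ = Counting Q?
    module CR = Counting R?

  total : ℕ → ℕ
  total N = CP.count N + CQ.count N + CR.count N

  hits : ℕ → ℕ
  hits j = CP.indicator j + CQ.indicator j + CR.indicator j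

  total-suc : ∀ N → total (suc N) ≡ hits N + total N
  total-suc N = solve 6 (λ a b c x y z → (a :+ x) :+ (b :+ y) :+ (c :+ z) := (a :+ b :+ c) :+ (x :+ y :+ z)) refl
    (CP.indicator N) (CQ.indicator N) (CR.indicator N) (CP.count N) (CQ.count N) (CR.count N)

  hit-once : ∀ {j} → P j ⊎ Q j ⊎ R j → 1 ≤ hits j
  hit-once {j} (inj₁ p) = ≤-trans (≤-reflexive (sym (CP.indicator-yes p)))
    (≤-trans (m≤m+n (CP.indicator j) (CQ.indicator j)) (m≤m+n _ (CR.indicator j)))
  hit-once {j} (inj₂ (inj₁ q)) = ≤-trans (≤-reflexive (sym (CQ.indicator-yes q)))
    (≤-trans (m≤n+m (CQ.indicator j) (CP.indicator j)) (m≤m+n _ (CR.indicator j)))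
  hit-once {j} (inj₂ (inj₂ r)) = ≤-trans (≤-reflexive (sym (CR.indicator-yes r)))
    (m≤n+m (CR.indicator j) (CP.indicator j + CQ.indicator j))

  hit-twice : ∀ {j} → P j → R j → 2 ≤ hits j
  hit-twice {j} p r = subst₂ (λ a c → 2 ≤ a + CQ.indicator j + c) (sym (CP.indicator-yes p)) (sym (CR.indicator-yes r))
                             (s≤s (m≤n+m 1 _))

  Covers : ℕ → Set
  Covers N = ∀ j → j < N → P j ⊎ Q j ⊎ R j

  cover-count : ∀ N → Covers N → N ≤ total N
  cover-count zero    _   = z≤n
  cover-count (suc N) cov = subst (suc N ≤_) (sym (total-suc N))
    (+-mono-≤ (hit-once (cov N ≤-refl)) (cover-count N (λ j j<N → cov j (m<n⇒m<1+n j<N))))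

  cover-count-twice : ∀ N i → i < N → P i → R i → Covers N → suc N ≤ total N
  cover-count-twice (suc N) i (s≤s i≤N) p r cov with m≤n⇒m<n∨m≡n i≤N
  ... | inj₂ refl = subst (suc (suc N) ≤_) (sym (total-suc N))
    (+-mono-≤ (hit-twice p r) (cover-count N (λ j j<N → cov j (m<n⇒m<1+n j<N))))
  ... | inj₁ i<N  = subst (suc (suc N) ≤_) (sym (total-suc N))
    (+-mono-≤ (hit-once (cov N ≤-refl)) (cover-count-twice N i i<N p r (λ j j<N → cov j (m<n⇒m<1+n j<N))))

Follows : ℕ → ℕ → ℕ → Set
Follows N p q = (suc p ≡ q) ⊎ (suc p ≡ N × q ≡ 0)

successor-mod : ∀ m p q → p < suc m → q < suc m → (suc p % suc m ≡ q) ⇔ Follows (suc m) p q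
successor-mod m p q p≤m q≤m with m≤n⇒m<n∨m≡n (≤-pred p≤m)
... | inj₁ p<m = mk⇔ (λ e → inj₁ (trans (sym (m<n⇒m%n≡m (s≤s p<m))) e))
  λ { (inj₁ e) → trans (m<n⇒m%n≡m (s≤s p<m)) e
    ; (inj₂ (e , _)) → ⊥-elim (<-irrefl (suc-injective e) p<m) }
... | inj₂ refl = mk⇔ (λ e → inj₂ (refl , trans (sym e) (n%n≡0 (suc m))))
  λ { (inj₁ e) → ⊥-elim (<-irrefl (sym e) q≤m)
    ; (inj₂ (_ , e)) → trans (n%n≡0 (suc m)) (sym e) }

Consecutive : ℕ → ℕ → ℕ → Set
Consecutive N p q = Follows N p q ⊎ Follows N q p

cycleAdj⇔consecutive : ∀ N (i j : Fin N) → CycleAdj N i j ⇔ Consecutive N (toℕ i) (toℕ j)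
cycleAdj⇔consecutive (suc m) i j = mk⇔
  (λ { (inj₁ e) → inj₁ (Equivalence.to (i→j) e) ; (inj₂ e) → inj₂ (Equivalence.to (j→i) e) })
  (λ { (inj₁ e) → inj₁ (Equivalence.from (i→j) e) ; (inj₂ e) → inj₂ (Equivalence.from (j→i) e) })
  where
  i→j = successor-mod m (toℕ i) (toℕ j) (toℕ<n i) (toℕ<n j)
  j→i = successor-mod m (toℕ j) (toℕ i) (toℕ<n j) (toℕ<n i)

even-or-odd : ∀ m → Even m ⊎ Even (suc m)
even-or-odd zero = inj₁ ev0
even-or-odd (suc m) with even-or-odd m
... | inj₁ e = inj₂ (ev+2 e)
... | inj₂ e = inj₁ e

half : ∀ {m} → Even m → ∃[ t ] m ≡ t + t
half ev0 = 0 , refl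
half (ev+2 e) with half e
... | t , refl = suc t , cong suc (sym (+-suc t t))

insert : ∀ {m} → Subset m → Fin m → Subset m
insert (_ ∷ S) F.zero    = inside ∷ S
insert (b ∷ S) (F.suc y) = b ∷ insert S y

insert-size : ∀ {m} (S : Subset m) y → ¬ (y ∈ S) → ∣ insert S y ∣ ≡ suc ∣ S ∣
insert-size (inside  ∷ S) F.zero    y∉S = ⊥-elim (y∉S here)
insert-size (outside ∷ S) F.zero    y∉S = refl
insert-size (inside  ∷ S) (F.suc y) y∉S = cong suc (insert-size S y (λ p → y∉S (there p)))
insert-size (outside ∷ S) (F.suc y) y∉S = insert-size S y (λ p → y∉S (there p))

insert-member : ∀ {m} (S : Subset m) y w → w ∈ insert S y → w ≡ y ⊎ w ∈ S
insert-member (_ ∷ S) F.zero    F.zero    _         = inj₁ refl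
insert-member (_ ∷ S) F.zero    (F.suc w) (there p) = inj₂ (there p)
insert-member (_ ∷ S) (F.suc y) F.zero    here      = inj₂ here
insert-member (_ ∷ S) (F.suc y) (F.suc w) (there p) with insert-member S y w p
... | inj₁ e = inj₁ (cong F.suc e)
... | inj₂ q = inj₂ (there q)

fromList : ∀ {m} → List (Fin m) → Subset m
fromList []       = Sub.⊥
fromList (y ∷ ys) = insert (fromList ys) y

fromList-member : ∀ {m} (P : Fin m → Set) ys → All P ys → ∀ w → w ∈ fromList ys → P w
fromList-member P []       []         w p = ⊥-elim (∉⊥ p)
fromList-member P (y ∷ ys) (Py ∷ Pys) w p with insert-member (fromList ys) y w p
... | inj₁ refl = Py
... | inj₂ q    = fromList-member P ys Pys w q

fromList-size : ∀ {m} (ys : List (Fin m)) → Unique ys → ∣ fromList ys ∣ ≡ length ys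
fromList-size {m} [] [] = ∣⊥∣≡0 m
fromList-size (y ∷ ys) (y∉ys ∷ u) =
  trans (insert-size (fromList ys) y (λ p → fromList-member (y ≢_) ys y∉ys y p refl))
        (cong suc (fromList-size ys u))

size≤1 : ∀ {m} (S : Subset m) → (∀ a b → a ∈ S → b ∈ S → a ≡ b) → ∣ S ∣ ≤ 1
size≤1 []            _ = z≤n
size≤1 {suc m} (inside  ∷ S) f =
  s≤s (≤-reflexive (trans (cong ∣_∣ (Empty-unique λ (a , a∈S) → 0≢suc (f F.zero (F.suc a) here (there a∈S))))
                          (∣⊥∣≡0 m)))
  where
  0≢suc : ∀ {m} {a : Fin m} → F.zero ≢ F.suc a
  0≢suc ()
size≤1 (outside ∷ S) f = size≤1 S λ a b a∈S b∈S → Fsuc-injective (f (F.suc a) (F.suc b) (there a∈S) (there b∈S))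

least-witness : (P : ℕ → Set) → (∀ k → Dec (P k)) → ∀ K → P K → ∃[ m ] P m × (∀ k → P k → m ≤ k)
least-witness P P? zero    PK = 0 , PK , λ _ _ → z≤n
least-witness P P? (suc K) PK with P? 0
... | yes P0 = 0 , P0 , λ _ _ → z≤n
... | no ¬P0 with least-witness (λ k → P (suc k)) (λ k → P? (suc k)) K PK
...   | m , Pm , least = suc m , Pm , minimal
  where
  minimal : ∀ k → P k → suc m ≤ k
  minimal zero    Pk = ⊥-elim (¬P0 Pk)
  minimal (suc k) Pk = s≤s (least k Pk)

¬¬-∀-Fin : ∀ {m} (P : Fin m → Set) → (∀ x → ¬ ¬ P x) → ¬ ¬ (∀ x → P x)
¬¬-∀-Fin {zero}  P h k = k λ ()
¬¬-∀-Fin {suc m} P h k = h F.zero λ P0 →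
  ¬¬-∀-Fin (λ x → P (F.suc x)) (λ x → h (F.suc x)) λ Ps → k λ { F.zero → P0 ; (F.suc x) → Ps x }

module WithDecidableAdjacency {n : ℕ} (G : Graph n) (adj? : ∀ u v → Dec (Adj G u v)) (conn : Connected G) where

  V : Set
  V = Fin n

  infix 4 _~_
  _~_ : V → V → Set
  _~_ = Adj G

  ~-sym : ∀ {u v} → u ~ v → v ~ u
  ~-sym = Graph.sym G _ _

  walk? : ∀ k u v → Dec (Walk G u v k)
  walk? zero u v with u ≟ᶠ v
  ... | yes refl = yes here
  ... | no u≢v   = no λ { here → u≢v refl }
  walk? (suc k) u v with any? (λ w → adj? u w ×-dec walk? k w v)
  ... | yes (w , u~w , p) = yes (step u~w p)
  ... | no none           = no λ { (step {w = w} u~w p) → none (w , u~w , p) }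

  shortest : ∀ u v → ∃[ m ] Walk G u v m × (∀ k → Walk G u v k → m ≤ k)
  shortest u v = least-witness (Walk G u v) (λ k → walk? k u v) (proj₁ (conn u v)) (proj₂ (conn u v))

  d : V → V → ℕ
  d u v = proj₁ (shortest u v)

  d-walk : ∀ u v → Walk G u v (d u v)
  d-walk u v = proj₁ (proj₂ (shortest u v))

  d-minimal : ∀ {u v k} → Walk G u v k → d u v ≤ k
  d-minimal {u} {v} {k} p = proj₂ (proj₂ (shortest u v)) k p

  d-isDist : ∀ u v → IsDist G u v (d u v)
  d-isDist u v = d-walk u v , λ _ p → d-minimal p

  isDist⇒≡d : ∀ {u v k} → IsDist G u v k → k ≡ d u v
  isDist⇒≡d {u} {v} (p , minimal) = ≤-antisym (minimal _ (d-walk u v)) (d-minimal p)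

  snoc : ∀ {u w v k} → Walk G u w k → w ~ v → Walk G u v (suc k)
  snoc here       w~v = step w~v here
  snoc (step a p) w~v = step a (snoc p w~v)

  reverse : ∀ {u v k} → Walk G u v k → Walk G v u k
  reverse here       = here
  reverse (step a p) = snoc (reverse p) (~-sym a)

  _++ʷ_ : ∀ {u w v k l} → Walk G u w k → Walk G w v l → Walk G u v (k + l)
  here     ++ʷ q = q
  step a p ++ʷ q = step a (p ++ʷ q)

  d-sym : ∀ u v → d u v ≡ d v u
  d-sym u v = ≤-antisym (d-minimal (reverse (d-walk v u))) (d-minimal (reverse (d-walk u v)))

  d-triangle : ∀ u w v → d u v ≤ d u w + d w v
  d-triangle u w v = d-minimal (d-walk u w ++ʷ d-walk w v)

  d-refl : ∀ u → d u u ≡ 0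
  d-refl u = n≤0⇒n≡0 (d-minimal here)

  d≡0⇒≡ : ∀ {u v} → d u v ≡ 0 → u ≡ v
  d≡0⇒≡ {u} {v} e with subst (Walk G u v) e (d-walk u v)
  ... | here = refl

  ~⇒d≡1 : ∀ {u v} → u ~ v → d u v ≡ 1
  ~⇒d≡1 {u} {v} u~v with d u v | d-minimal (step u~v here) | d≡0⇒≡ {u} {v}
  ... | zero        | _        | ≡0⇒≡ = ⊥-elim (Graph.irrefl G u (subst (u ~_) (sym (≡0⇒≡ refl)) u~v))
  ... | suc zero    | _        | _    = refl
  ... | suc (suc _) | s≤s ()   | _

  d-lipschitzˡ : ∀ {u w} v → u ~ w → d u v ≤ suc (d w v)
  d-lipschitzˡ {u} {w} v u~w = subst (λ x → d u v ≤ x + d w v) (~⇒d≡1 u~w) (d-triangle u w v)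

  d-lipschitzʳ : ∀ u {w w′} → w ~ w′ → d u w ≤ suc (d u w′)
  d-lipschitzʳ u {w} {w′} w~w′ = subst₂ _≤_ (d-sym w u) (cong suc (d-sym w′ u)) (d-lipschitzˡ u w~w′)

  d-step : ∀ {u v k} → d u v ≡ suc k → ∃[ w ] u ~ w × d w v ≡ k
  d-step {u} {v} {k} e with subst (Walk G u v) e (d-walk u v)
  ... | step {w = w} u~w p = w , u~w , ≤-antisym (d-minimal p) (≤-pred (subst (_≤ suc (d w v)) e (d-lipschitzˡ v u~w)))

  potential-bound : (h : V → ℕ) (t : V) → h t ≡ 0 → (∀ u w → u ~ w → h u ≤ suc (h w)) → ∀ u → h u ≤ d u t
  potential-bound h t ht≡0 lip u = along (d-walk u t)
    where
    along : ∀ {u k} → Walk G u t k → h u ≤ k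
    along here                          = ≤-reflexive ht≡0
    along (step {u = u} {w = w} u~w p) = ≤-trans (lip u w u~w) (s≤s (along p))

  -- Resolving pairs.

  Equidistant : V → V → V → Set
  Equidistant x y w = d w x ≡ d w y

  resolves⇒≢ : ∀ {w x y} → Resolves G w x y → d w x ≢ d w y
  resolves⇒≢ {w} {x} {y} r = r _ _ (d-isDist w x) (d-isDist w y)

  ≢⇒resolves : ∀ {w x y} → d w x ≢ d w y → Resolves G w x y
  ≢⇒resolves ne k l p q e = ne (trans (sym (isDist⇒≡d p)) (trans e (isDist⇒≡d q)))

  nonresolvers<r : ∀ r → AllResolving G r → ∀ x y → x ≢ y → (ws : List V) → Unique ws →
                   All (Equidistant x y) ws → length ws < r
  nonresolvers<r r all-res x y x≢y ws u eq with r ≤? length ws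
  ... | no r≰ = ≰⇒> r≰
  ... | yes r≤ with all-res (fromList (take r ws)) size x y x≢y
    where
    size : ∣ fromList (take r ws) ∣ ≡ r
    size = trans (fromList-size _ (Unique.take⁺ r u)) (trans (length-take r ws) (m≤n⇒m⊓n≡m r≤))
  ...   | w , w∈ , w-resolves =
    ⊥-elim (resolves⇒≢ w-resolves (fromList-member (Equidistant x y) (take r ws) (All.take⁺ r eq) w w∈))

  all-resolving-2 : (∀ x y → x ≢ y → ∀ a b → Equidistant x y a → Equidistant x y b → a ≡ b) → AllResolving G 2
  all-resolving-2 unique S |S|≡2 x y x≢y with any? (λ w → (w ∈? S) ×-dec ¬? (d w x ≟ d w y))
  ... | yes (w , w∈S , ne) = w , w∈S , ≢⇒resolves ne
  ... | no none = ⊥-elim (2≰1 (subst (_≤ 1) |S|≡2 (size≤1 S λ a b a∈S b∈S →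
                    unique x y x≢y a b (equidistant a a∈S) (equidistant b b∈S))))
    where
    equidistant : ∀ a → a ∈ S → Equidistant x y a
    equidistant a a∈S = decidable-stable (d a x ≟ d a y) λ ne → none (a , a∈S , ne)
    2≰1 : ¬ (2 ≤ 1)
    2≰1 (s≤s ())

  -- Paths and geodesics, indexed by ℕ.

  IsPath : ℕ → (ℕ → V) → Set
  IsPath k p = ∀ i → i < k → p i ~ p (suc i)

  Geodesic : ℕ → (ℕ → V) → Set
  Geodesic D v = ∀ a b → a ≤ D → b ≤ D → d (v a) (v b) ≡ ∣ a - b ∣

  path-short : ∀ k p → IsPath k p → ∀ i m → i + m ≤ k → d (p i) (p (i + m)) ≤ m
  path-short k p path i zero    _ = ≤-reflexive (trans (cong (λ j → d (p i) (p j)) (+-identityʳ i)) (d-refl (p i)))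
  path-short k p path i (suc m) i+m+1≤k = begin
    d (p i) (p (i + suc m))                           ≤⟨ d-triangle (p i) (p (i + m)) (p (i + suc m)) ⟩
    d (p i) (p (i + m)) + d (p (i + m)) (p (i + suc m)) ≡⟨ cong (λ x → d (p i) (p (i + m)) + d (p (i + m)) (p x)) (+-suc i m) ⟩
    d (p i) (p (i + m)) + d (p (i + m)) (p (suc (i + m))) ≤⟨ +-mono-≤ (path-short k p path i m (≤-trans (+-monoʳ-≤ i (n≤1+n m)) i+m+1≤k))
                                                                   (≤-reflexive (~⇒d≡1 (path (i + m) (subst (_≤ k) (+-suc i m) i+m+1≤k)))) ⟩
    m + 1                                             ≡⟨ +-comm m 1 ⟩
    suc m                                             ∎
    where open ≤-Reasoning

  path-short-∣∣ : ∀ k p → IsPath k p → ∀ i j → i ≤ k → j ≤ k → d (p i) (p j) ≤ ∣ i - j ∣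
  path-short-∣∣ k p path i j i≤k j≤k with ≤-total i j
  ... | inj₁ i≤j with m≤n⇒∃[o]m+o≡n i≤j
  ...   | m , refl = subst (d (p i) (p (i + m)) ≤_) (sym (∣m-m+n∣≡n i m)) (path-short k p path i m j≤k)
  path-short-∣∣ k p path i j i≤k j≤k | inj₂ j≤i with m≤n⇒∃[o]m+o≡n j≤i
  ...   | m , refl = subst₂ _≤_ (d-sym (p j) (p (j + m))) (sym (proj₂ (∣-∣-gap j m _ refl))) (path-short k p path j m i≤k)

  shortest-path : ∀ k u v → d u v ≡ k → ∃[ p ] p 0 ≡ u × p k ≡ v × IsPath k p
  shortest-path zero    u v e = (λ _ → u) , refl , d≡0⇒≡ e , λ _ ()
  shortest-path (suc k) u v e with d-step e
  ... | w , u~w , e′ with shortest-path k w v e′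
  ...   | p , p0≡w , pk≡v , path = q , refl , pk≡v , path′
    where
    q : ℕ → V
    q zero    = u
    q (suc i) = p i
    path′ : IsPath (suc k) q
    path′ zero    _         = subst (u ~_) (sym p0≡w) u~w
    path′ (suc i) (s≤s i<k) = path i i<k

  path-geodesic-≤ : ∀ k p → IsPath k p → d (p 0) (p k) ≡ k → ∀ a b → a ≤ b → b ≤ k → d (p a) (p b) ≡ b ∸ a
  path-geodesic-≤ k p path ends a b a≤b b≤k =
    ≤-antisym (≤-trans (path-short-∣∣ k p path a b (≤-trans a≤b b≤k) b≤k) (≤-reflexive (m≤n⇒∣m-n∣≡n∸m a≤b))) lower
    where
    around : k ≤ a + d (p a) (p b) + (k ∸ b)
    around = begin
      k                                               ≡⟨ sym ends ⟩
      d (p 0) (p k)                                   ≤⟨ d-triangle (p 0) (p b) (p k) ⟩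
      d (p 0) (p b) + d (p b) (p k)                   ≤⟨ +-monoˡ-≤ _ (d-triangle (p 0) (p a) (p b)) ⟩
      d (p 0) (p a) + d (p a) (p b) + d (p b) (p k)   ≤⟨ +-mono-≤ (+-monoˡ-≤ _ (path-short k p path 0 a (≤-trans a≤b b≤k)))
                                                                  (subst (λ x → d (p b) (p x) ≤ k ∸ b) (m+[n∸m]≡n b≤k)
                                                                         (path-short k p path b (k ∸ b) (≤-reflexive (m+[n∸m]≡n b≤k)))) ⟩
      a + d (p a) (p b) + (k ∸ b)                     ∎
      where open ≤-Reasoning
    lower : b ∸ a ≤ d (p a) (p b)
    lower = +-cancelˡ-≤ a _ _ (subst (_≤ a + d (p a) (p b)) (sym (m+[n∸m]≡n a≤b))
              (+-cancelʳ-≤ (k ∸ b) b _ (subst (_≤ a + d (p a) (p b) + (k ∸ b)) (sym (m+[n∸m]≡n b≤k)) around)))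

  path-geodesic : ∀ k p → IsPath k p → d (p 0) (p k) ≡ k → Geodesic k p
  path-geodesic k p path ends a b a≤k b≤k with ≤-total a b
  ... | inj₁ a≤b = trans (path-geodesic-≤ k p path ends a b a≤b b≤k) (sym (m≤n⇒∣m-n∣≡n∸m a≤b))
  ... | inj₂ b≤a = trans (d-sym (p a) (p b)) (trans (path-geodesic-≤ k p path ends b a b≤a a≤k) (sym (m≤n⇒∣n-m∣≡n∸m b≤a)))

  geodesic-injective : ∀ {D v} → Geodesic D v → ∀ a b → a ≤ D → b ≤ D → v a ≡ v b → a ≡ b
  geodesic-injective {D} {v} geo a b a≤D b≤D e =
    ∣m-n∣≡0⇒m≡n (trans (sym (geo a b a≤D b≤D)) (trans (cong (d (v a)) (sym e)) (d-refl _)))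

  geodesic-edge : ∀ {D v} → Geodesic D v → ∀ a b → a ≤ D → b ≤ D → v a ~ v b → b ≡ suc a ⊎ a ≡ suc b
  geodesic-edge geo a b a≤D b≤D va~vb = ∣-∣≡1⇒consecutive a b (trans (sym (geo a b a≤D b≤D)) (~⇒d≡1 va~vb))

  geodesic-cong : ∀ {D u w} → (∀ a → a ≤ D → u a ≡ w a) → Geodesic D u → Geodesic D w
  geodesic-cong {D} {u} {w} e geo a b a≤D b≤D = subst₂ (λ x y → d x y ≡ ∣ a - b ∣) (e a a≤D) (e b b≤D) (geo a b a≤D b≤D)

  geodesic-reverse : ∀ {D v} → Geodesic D v → Geodesic D (λ a → v (D ∸ a))
  geodesic-reverse {D} {v} geo a b a≤D b≤D = trans (geo (D ∸ a) (D ∸ b) (m∸n≤m D a) (m∸n≤m D b)) (∣∸-∸∣ D a b a≤D b≤D)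

  ManyNonresolvers : ℕ → Set
  ManyNonresolvers D = ∃[ x ] ∃[ y ] x ≢ y × ∃[ ws ] Unique ws × All (Equidistant x y) ws × D + 2 ≤ 3 * length ws

  many-nonresolvers-bound : ∀ D r → ManyNonresolvers D → AllResolving G r → D + 5 ≤ 3 * r
  many-nonresolvers-bound D r (x , y , x≢y , ws , u , eq , D+2≤) all-res = begin
    D + 5                  ≡⟨ +-assoc D 2 3 ⟨
    D + 2 + 3              ≤⟨ +-monoˡ-≤ 3 D+2≤ ⟩
    3 * length ws + 3      ≡⟨ solve 1 (λ k → con 3 :* k :+ con 3 := con 3 :* (con 1 :+ k)) refl (length ws) ⟩
    3 * suc (length ws)    ≤⟨ *-monoʳ-≤ 3 (nonresolvers<r r all-res x y x≢y ws u eq) ⟩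
    3 * r                  ∎
    where open ≤-Reasoning

  -- From every v j,
  -- z is as far as one of v a, v (1 + a), v (2 + a), and from v (1 + a) as far as two of them;
  -- so one of these three vertices forms with z a pair with at least (D + 2) / 3 non-resolving vertices.
  module OffGeodesicNeighbour (D : ℕ) (v : ℕ → V) (geo : Geodesic D v) (z : V) (z-off : ∀ j → j ≤ D → z ≢ v j)
                              (a : ℕ) (a+2≤D : 2 + a ≤ D) (z~ : z ~ v (1 + a)) where

    Twin : V → ℕ → Set
    Twin X j = d (v j) z ≡ d (v j) X

    twin? : ∀ X j → Dec (Twin X j)
    twin? X j = d (v j) z ≟ d (v j) X

    A B C : V
    A = v a
    B = v (1 + a)
    C = v (2 + a)

    a≤D : a ≤ D
    a≤D = ≤-trans (n≤1+n a) (≤-trans (n≤1+n (1 + a)) a+2≤D)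
    a+1≤D : 1 + a ≤ D
    a+1≤D = ≤-trans (n≤1+n (1 + a)) a+2≤D

    Spread : ℕ → ℕ → Set
    Spread j t = d (v j) B ≡ 1 + t × (d (v j) A ≡ t × d (v j) C ≡ 2 + t ⊎ d (v j) C ≡ t × d (v j) A ≡ 2 + t)

    spread : ∀ j → j ≤ D → j ≢ 1 + a → ∃[ t ] Spread j t
    spread j j≤D j≢ with <-cmp j (1 + a)
    ... | tri≈ _ j≡ _ = ⊥-elim (j≢ j≡)
    ... | tri< (s≤s j≤a) _ _ with m≤n⇒∃[o]m+o≡n j≤a
    ...   | t , refl = t , dist (1 + a) a+1≤D (1 + t) (+-suc j t) ,
                         inj₁ (dist a a≤D t refl , dist (2 + a) a+2≤D (2 + t) (trans (+-suc j (1 + t)) (cong suc (+-suc j t))))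
      where
      dist : ∀ i → i ≤ D → ∀ s → j + s ≡ i → d (v j) (v i) ≡ s
      dist i i≤D s e = trans (geo j i j≤D i≤D) (proj₁ (∣-∣-gap j s i e))
    spread j j≤D j≢ | tri> _ _ a+2≤j with m≤n⇒∃[o]m+o≡n a+2≤j
    ...   | t , refl = t , dist (1 + a) a+1≤D (1 + t) (+-suc (1 + a) t) ,
                         inj₂ (dist (2 + a) a+2≤D t refl , dist a a≤D (2 + t) (trans (+-suc a (1 + t)) (cong suc (+-suc a t))))
      where
      dist : ∀ i → i ≤ D → ∀ s → i + s ≡ j → d (v j) (v i) ≡ s
      dist i i≤D s e = trans (geo j i j≤D i≤D) (proj₂ (∣-∣-gap i s j e))

    -- v (1 + a) is adjacent to both z and A, and to both z and C.
    middle-twin : ∀ i → i ≤ D → ∣ 1 + a - i ∣ ≡ 1 → Twin (v i) (1 + a)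
    middle-twin i i≤D e = trans (~⇒d≡1 (~-sym z~)) (sym (trans (geo (1 + a) i a+1≤D i≤D) e))

    twins-cover : ∀ j → j ≤ D → Twin A j ⊎ Twin B j ⊎ Twin C j
    twins-cover j j≤D with j ≟ 1 + a
    ... | yes refl = inj₁ (middle-twin a a≤D (proj₂ (∣-∣-gap a 1 (1 + a) (+-comm a 1))))
    ... | no j≢ with spread j j≤D j≢
    ...   | t , dB , sides with within-one t (d (v j) z) z-close z-far
      where
      z-close : d (v j) z ≤ 2 + t
      z-close = subst (λ x → d (v j) z ≤ suc x) dB (d-lipschitzʳ (v j) z~)
      z-far : t ≤ d (v j) z
      z-far = ≤-pred (subst (_≤ suc (d (v j) z)) dB (d-lipschitzʳ (v j) (~-sym z~)))
    ...     | inj₂ (inj₁ e) = inj₂ (inj₁ (trans e (sym dB)))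
    ...     | inj₁ e        with sides
    ...       | inj₁ (dA , _) = inj₁ (trans e (sym dA))
    ...       | inj₂ (dC , _) = inj₂ (inj₂ (trans e (sym dC)))
    twins-cover j j≤D | no j≢ | t , dB , sides | inj₂ (inj₂ e) with sides
    ...       | inj₁ (_ , dC) = inj₂ (inj₂ (trans e (sym dC)))
    ...       | inj₂ (_ , dA) = inj₁ (trans e (sym dA))

    many-twins : ∀ X → z ≢ X → D + 2 ≤ 3 * Counting.count (twin? X) (suc D) → ManyNonresolvers D
    many-twins X z≢X D+2≤ = z , X , z≢X , selected v (suc D) ,
      selected-unique v (suc D) (λ i j i≤D j≤D → geodesic-injective geo i j (≤-pred i≤D) (≤-pred j≤D)) ,
      All.map (λ { (j , _ , twin , refl) → twin }) (selected-origin v (suc D)) ,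
      subst (λ k → D + 2 ≤ 3 * k) (sym (selected-length v (suc D))) D+2≤
      where open Counting (twin? X)

    twins-total : D + 2 ≤ Cover.total (twin? A) (twin? B) (twin? C) (suc D)
    twins-total = subst (_≤ total (suc D)) (+-comm 2 D)
      (cover-count-twice (suc D) (1 + a) (s≤s a+1≤D)
        (middle-twin a a≤D (proj₂ (∣-∣-gap a 1 (1 + a) (+-comm a 1))))
        (middle-twin (2 + a) a+2≤D (proj₁ (∣-∣-gap (1 + a) 1 (2 + a) (+-comm (1 + a) 1))))
        (λ j j≤D → twins-cover j (≤-pred j≤D)))
      where open Cover (twin? A) (twin? B) (twin? C)

    result : ManyNonresolvers D
    result with pigeonhole₃ (D + 2) (count A) (count B) (count C) twins-total
      where
      count : V → ℕ
      count X = Counting.count (twin? X) (suc D)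
    ... | inj₁ many        = many-twins A (z-off a a≤D) many
    ... | inj₂ (inj₁ many) = many-twins B (z-off (1 + a) a+1≤D) many
    ... | inj₂ (inj₂ many) = many-twins C (z-off (2 + a) a+2≤D) many

  Within : ℕ → (ℕ → V) → V → Set
  Within K v w = ∃[ j ] j ≤ K × w ≡ v j

  within? : ∀ K v w → Dec (Within K v w)
  within? K v w = map′ (λ (j , j<K+1 , e) → j , ≤-pred j<K+1 , e) (λ (j , j≤K , e) → j , s≤s j≤K , e)
                       (anyUpTo? (λ j → w ≟ᶠ v j) (suc K))

  ¬within⇒off : ∀ {K v w} → ¬ Within K v w → ∀ j → j ≤ K → w ≢ v j
  ¬within⇒off ¬within j j≤K e = ¬within (j , j≤K , e)

  InnerClosed : ℕ → (ℕ → V) → Set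
  InnerClosed D v = ∀ i → 1 ≤ i → i < D → ∀ w → v i ~ w → Within D v w

  infixr 5 _◂_
  _◂_ : V → (ℕ → V) → ℕ → V
  (z ◂ v) zero    = z
  (z ◂ v) (suc a) = v a

  module Prepend (D : ℕ) (v : ℕ → V) (geo : Geodesic D v) (closed : InnerClosed D v)
                 (z : V) (z-off : ∀ j → j ≤ D → z ≢ v j) (z~ : z ~ v 0) where

    -- A shortest walk from v j to z runs along the geodesic and leaves it through v 0 or through v D;
    -- in the second case it has length at least (D ∸ j) + (D ∸ 1).
    escape : ∀ k j → j ≤ D → d (v j) z ≡ k → suc j ≤ k ⊎ D + D ≤ k + suc j
    escape zero    j       j≤D e = ⊥-elim (z-off j j≤D (sym (d≡0⇒≡ e)))
    escape (suc k) zero    _   e = inj₁ (s≤s z≤n)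
    escape (suc k) (suc j) j≤D e with suc j ≟ D
    ... | yes refl = inj₂ (subst (D + D ≤_) (sym (+-suc (suc k) D)) (+-monoˡ-≤ D D≤k+2))
      where
      D≤k+2 : D ≤ suc (suc k)
      D≤k+2 = begin
        D                     ≡⟨ sym (geo 0 D z≤n ≤-refl) ⟩
        d (v 0) (v D)         ≤⟨ d-triangle (v 0) z (v D) ⟩
        d (v 0) z + d z (v D) ≡⟨ cong₂ _+_ (~⇒d≡1 (~-sym z~)) (trans (d-sym z (v D)) e) ⟩
        suc (suc k)           ∎
        where open ≤-Reasoning
    ... | no j+1≢D with d-step e
    ...   | u , vj+1~u , du≡k with closed (suc j) (s≤s z≤n) (≤∧≢⇒< j≤D j+1≢D) u vj+1~u
    ...     | j′ , j′≤D , refl with geodesic-edge geo (suc j) j′ j≤D j′≤D vj+1~u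
    ...       | inj₁ refl with escape k (suc (suc j)) j′≤D du≡k
    ...         | inj₁ p = inj₁ (m≤n⇒m≤1+n (≤-trans (n≤1+n _) p))
    ...         | inj₂ p = inj₂ (subst (D + D ≤_) (+-suc k (suc (suc j))) p)
    escape (suc k) (suc j) j≤D e | no _ | u , _ , du≡k | j′ , j′≤D , refl | inj₂ refl with escape k j′ j′≤D du≡k
    ...         | inj₁ p = inj₁ (s≤s p)
    ...         | inj₂ p = inj₂ (≤-trans p (≤-trans (n≤1+n _) (s≤s (+-monoʳ-≤ k (n≤1+n (suc j′))))))

    z-distance : ∀ b → b < D → d z (v b) ≡ suc b
    z-distance b b<D = ≤-antisym upper lower
      where
      upper : d z (v b) ≤ suc b
      upper = ≤-trans (d-triangle z (v 0) (v b)) (≤-reflexive (cong₂ _+_ (~⇒d≡1 z~) (geo 0 b z≤n (<⇒≤ b<D))))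
      lower : suc b ≤ d z (v b)
      lower with escape _ b (<⇒≤ b<D) refl
      ... | inj₁ p = subst (suc b ≤_) (d-sym (v b) z) p
      ... | inj₂ p = subst (suc b ≤_) (d-sym (v b) z)
                       (≤-trans b<D (+-cancelʳ-≤ D D _ (≤-trans p (+-monoʳ-≤ (d (v b) z) b<D))))

    prepend-geodesic : Geodesic D (z ◂ v)
    prepend-geodesic zero    zero    _   _   = d-refl z
    prepend-geodesic zero    (suc b) _   b<D = z-distance b b<D
    prepend-geodesic (suc a) zero    a<D _   = trans (d-sym (v a) z) (z-distance a a<D)
    prepend-geodesic (suc a) (suc b) a<D b<D = geo a b (≤-trans (n≤1+n a) a<D) (≤-trans (n≤1+n b) b<D)

  -- Strands: growing a diametral geodesic whose inner vertices have degree two.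
  module Strands (D : ℕ) (2≤D : 2 ≤ D) where

    record Strand : Set where
      field
        K             : ℕ
        s             : ℕ → V
        D≤K           : D ≤ K
        distinct      : ∀ i j → i ≤ K → j ≤ K → s i ≡ s j → i ≡ j
        path          : IsPath K s
        inner         : ∀ i → 1 ≤ i → i < K → ∀ w → s i ~ w → w ≡ s (pred i) ⊎ w ≡ s (suc i)
        head-geodesic : Geodesic D s
        tail-geodesic : Geodesic D (λ a → s (K ∸ D + a))
    open Strand

    OnStrand : Strand → V → Set
    OnStrand st = Within (K st) (s st)

    on? : ∀ st w → Dec (OnStrand st w)
    on? st = within? (K st) (s st)

    2≤K : ∀ st → 2 ≤ K st
    2≤K st = ≤-trans 2≤D (D≤K st)

    suc-pred-K : ∀ st → suc (pred (K st)) ≡ K st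
    suc-pred-K st with K st | 2≤K st
    ... | suc _ | _ = refl

    pred-K≤K : ∀ st → pred (K st) ≤ K st
    pred-K≤K st = ≤-trans (n≤1+n _) (≤-reflexive (suc-pred-K st))

    size-bound : ∀ st → suc (K st) ≤ n
    size-bound st = injective⇒≤ {f = λ i → s st (toℕ i)} λ {i} {j} e →
      toℕ-injective (distinct st (toℕ i) (toℕ j) (≤-pred (toℕ<n i)) (≤-pred (toℕ<n j)) e)

    head-neighbours : ∀ st w → s st 0 ~ w → OnStrand st w → w ≡ s st 1 ⊎ w ≡ s st (K st)
    head-neighbours st w s0~w (zero , _ , refl) = ⊥-elim (Graph.irrefl G _ s0~w)
    head-neighbours st w s0~w (suc zero , _ , e) = inj₁ e
    head-neighbours st w s0~w (suc (suc j) , j≤K , e) with suc (suc j) ≟ K st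
    ... | yes j+2≡K = inj₂ (trans e (cong (s st) j+2≡K))
    ... | no j+2≢K with inner st (suc (suc j)) (s≤s z≤n) (≤∧≢⇒< j≤K j+2≢K) (s st 0) (~-sym (subst (s st 0 ~_) e s0~w))
    ...   | inj₁ e′ = ⊥-elim (1+n≢0 (distinct st (suc j) 0 (≤-trans (n≤1+n _) j≤K) z≤n (sym e′)))
    ...   | inj₂ e′ = ⊥-elim (1+n≢0 (sym (distinct st 0 (suc (suc (suc j))) z≤n (≤∧≢⇒< j≤K j+2≢K) e′)))

    tail-neighbours : ∀ st w → s st (K st) ~ w → OnStrand st w → w ≡ s st (pred (K st)) ⊎ w ≡ s st 0
    tail-neighbours st w sK~w (zero , _ , e) = inj₂ e
    tail-neighbours st w sK~w (suc j , j≤K , e) with suc j ≟ K st | suc (suc j) ≟ K st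
    ... | yes j+1≡K | _ = ⊥-elim (Graph.irrefl G _ (subst (s st (K st) ~_) (trans e (cong (s st) j+1≡K)) sK~w))
    ... | no _ | yes j+2≡K = inj₁ (trans e (cong (λ x → s st (pred x)) j+2≡K))
    ... | no j+1≢K | no j+2≢K with inner st (suc j) (s≤s z≤n) (≤∧≢⇒< j≤K j+1≢K) (s st (K st))
                                     (~-sym (subst (s st (K st) ~_) e sK~w))
    ...   | inj₁ e′ = ⊥-elim (<-irrefl refl
                        (subst (suc j ≤_) (distinct st (K st) j ≤-refl (≤-trans (n≤1+n j) j≤K) e′) j≤K))
    ...   | inj₂ e′ = ⊥-elim (j+2≢K (sym
                        (distinct st (K st) (suc (suc j)) ≤-refl (<⇒≤ (≤∧≢⇒< (≤∧≢⇒< j≤K j+1≢K) j+2≢K)) e′)))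

    head-closed : ∀ st → InnerClosed D (s st)
    head-closed st i 1≤i i<D w si~w with inner st i 1≤i (≤-trans i<D (D≤K st)) w si~w
    ... | inj₁ e = pred i , ≤-trans pred[n]≤n (<⇒≤ i<D) , e
    ... | inj₂ e = suc i , i<D , e

    prepend : (st : Strand) (t : V) → t ~ s st 0 → (∀ j → j ≤ K st → t ≢ s st j) →
              (∀ w → s st 0 ~ w → w ≡ t ⊎ w ≡ s st 1) → Strand
    prepend st t t~s0 t-off s0-nbrs = record
      { K             = suc (K st)
      ; s             = t ◂ s st
      ; D≤K           = ≤-trans (D≤K st) (n≤1+n _)
      ; distinct      = distinct′
      ; path          = path′
      ; inner         = inner′
      ; head-geodesic = Prepend.prepend-geodesic D (s st) (head-geodesic st) (head-closed st) t
                          (λ j j≤D → t-off j (≤-trans j≤D (D≤K st))) t~s0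
      ; tail-geodesic = geodesic-cong (λ a _ → cong (λ x → (t ◂ s st) (x + a)) (sym (+-∸-assoc 1 (D≤K st))))
                                      (tail-geodesic st)
      }
      where
      distinct′ : ∀ i j → i ≤ suc (K st) → j ≤ suc (K st) → (t ◂ s st) i ≡ (t ◂ s st) j → i ≡ j
      distinct′ zero    zero    _   _   _ = refl
      distinct′ zero    (suc j) _   j≤K e = ⊥-elim (t-off j (≤-pred j≤K) e)
      distinct′ (suc i) zero    i≤K _   e = ⊥-elim (t-off i (≤-pred i≤K) (sym e))
      distinct′ (suc i) (suc j) i≤K j≤K e = cong suc (distinct st i j (≤-pred i≤K) (≤-pred j≤K) e)
      path′ : IsPath (suc (K st)) (t ◂ s st)
      path′ zero    _   = t~s0
      path′ (suc i) i<K = path st i (≤-pred i<K)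
      inner′ : ∀ i → 1 ≤ i → i < suc (K st) → ∀ w → (t ◂ s st) i ~ w →
               w ≡ (t ◂ s st) (pred i) ⊎ w ≡ (t ◂ s st) (suc i)
      inner′ (suc zero)    _ _   w s0~w = s0-nbrs w s0~w
      inner′ (suc (suc i)) _ i<K w si~w = inner st (suc i) (s≤s z≤n) (≤-pred i<K) w si~w

    SameTail : Strand → Strand → Set
    SameTail st st′ = s st′ (K st′) ≡ s st (K st) × s st′ (pred (K st′)) ≡ s st (pred (K st))

    same-tail-trans : ∀ {st st′ st″} → SameTail st st′ → SameTail st′ st″ → SameTail st st″
    same-tail-trans (p , q) (p′ , q′) = trans p′ p , trans q′ q

    HeadEnd : Strand → Set
    HeadEnd st = ∀ w → s st 0 ~ w → w ≡ s st 1

    HeadCycle : Strand → Set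
    HeadCycle st = s st 0 ~ s st (K st) × (∀ w → s st 0 ~ w → w ≡ s st 1 ⊎ w ≡ s st (K st))

    data Grown (st : Strand) : Set where
      found : ManyNonresolvers D → Grown st
      end   : (st′ : Strand) → SameTail st st′ → HeadEnd st′ → Grown st
      cycle : (st′ : Strand) → SameTail st st′ → HeadCycle st′ → Grown st

    grown-trans : ∀ {st st′} → SameTail st st′ → Grown st′ → Grown st
    grown-trans same (found many)      = found many
    grown-trans {st} {st′} same (end st″ same′ e)   = end st″ (same-tail-trans {st} {st′} {st″} same same′) e
    grown-trans {st} {st′} same (cycle st″ same′ c) = cycle st″ (same-tail-trans {st} {st′} {st″} same same′) c

    stuck : ∀ st → (∀ w → s st 0 ~ w → OnStrand st w) → Grown st
    stuck st on with adj? (s st 0) (s st (K st))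
    ... | yes s0~sK = cycle st (refl , refl) (s0~sK , λ w s0~w → head-neighbours st w s0~w (on w s0~w))
    ... | no ¬s0~sK = end st (refl , refl) λ w s0~w → only w s0~w (head-neighbours st w s0~w (on w s0~w))
      where
      only : ∀ w → s st 0 ~ w → w ≡ s st 1 ⊎ w ≡ s st (K st) → w ≡ s st 1
      only w _    (inj₁ e) = e
      only w s0~w (inj₂ e) = ⊥-elim (¬s0~sK (subst (s st 0 ~_) e s0~w))

    -- If the head has a neighbour t off the strand and a third neighbour u ∉ {t, s 1}, then u is adjacent
    -- to the inner vertex s 0 of the geodesic t, s 0, …, s (D ∸ 1), but lies off it.
    third-neighbour : ∀ st t → s st 0 ~ t → ¬ OnStrand st t → ∀ u → s st 0 ~ u → u ≢ t → u ≢ s st 1 →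
                      ManyNonresolvers D
    third-neighbour st t s0~t t-off u s0~u u≢t u≢s1 =
      OffGeodesicNeighbour.result D (t ◂ s st) geo u u-off 0 2≤D (~-sym s0~u)
      where
      geo : Geodesic D (t ◂ s st)
      geo = Prepend.prepend-geodesic D (s st) (head-geodesic st) (head-closed st) t
              (λ j j≤D → ¬within⇒off t-off j (≤-trans j≤D (D≤K st))) (~-sym s0~t)
      u-off : ∀ j → j ≤ D → u ≢ (t ◂ s st) j
      u-off zero    _   e = u≢t e
      u-off (suc j) j<D e with geodesic-edge (head-geodesic st) 0 j z≤n (≤-trans (n≤1+n j) j<D) (subst (s st 0 ~_) e s0~u)
      ... | inj₁ refl = u≢s1 e

    -- Grow the strand at its head as long as the head has exactly one neighbour off the strand;
    -- the strand can have at most n vertices, which bounds the number of steps.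
    grow : ∀ fuel st → suc (K st) + fuel ≡ n → Grown st
    grow fuel st size with any? (λ t → adj? (s st 0) t ×-dec ¬? (on? st t))
    ... | no none = stuck st λ w s0~w → decidable-stable (on? st w) λ ¬on → none (w , s0~w , ¬on)
    ... | yes (t , s0~t , t-off) with any? (λ u → adj? (s st 0) u ×-dec (¬? (u ≟ᶠ t) ×-dec ¬? (u ≟ᶠ s st 1)))
    ...   | yes (u , s0~u , u≢t , u≢s1) = found (third-neighbour st t s0~t t-off u s0~u u≢t u≢s1)
    ...   | no none = continue fuel size
      where
      s0-neighbours : ∀ w → s st 0 ~ w → w ≡ t ⊎ w ≡ s st 1
      s0-neighbours w s0~w with w ≟ᶠ t | w ≟ᶠ s st 1
      ... | yes e   | _       = inj₁ e
      ... | no _    | yes e   = inj₂ e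
      ... | no w≢t  | no w≢s1 = ⊥-elim (none (w , s0~w , w≢t , w≢s1))
      st′ : Strand
      st′ = prepend st t (~-sym s0~t) (¬within⇒off t-off) s0-neighbours
      continue : ∀ fuel → suc (K st) + fuel ≡ n → Grown st
      continue zero size = ⊥-elim (<-irrefl refl (subst (suc (suc (K st)) ≤_) (trans (sym size) (+-identityʳ _)) (size-bound st′)))
      continue (suc fuel) size = grown-trans {st} {st′} (refl , cong (t ◂ s st) (sym (suc-pred-K st)))
                                             (grow fuel st′ (trans (sym (+-suc (suc (K st)) fuel)) size))

    grow-all : ∀ st → Grown st
    grow-all st = grow (n ∸ suc (K st)) st (m+[n∸m]≡n (size-bound st))

    reverse-strand : Strand → Strand
    reverse-strand st = record
      { K             = K st
      ; s             = λ i → s st (K st ∸ i)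
      ; D≤K           = D≤K st
      ; distinct      = λ i j i≤K j≤K e → ∸-cancelˡ-≡ i≤K j≤K (distinct st _ _ (m∸n≤m _ i) (m∸n≤m _ j) e)
      ; path          = path′
      ; inner         = inner′
      ; head-geodesic = geodesic-cong (λ a a≤D → cong (s st) (∸-window (K st) D a (D≤K st) a≤D))
                                      (geodesic-reverse (tail-geodesic st))
      ; tail-geodesic = geodesic-cong (λ a _ → cong (s st) (sym (∸-window′ (K st) D a (D≤K st))))
                                      (geodesic-reverse (head-geodesic st))
      }
      where
      path′ : IsPath (K st) (λ i → s st (K st ∸ i))
      path′ i i<K = subst (λ x → s st x ~ s st (K st ∸ suc i)) (sym (∸-unfold (K st) i i<K))
                      (~-sym (path st (K st ∸ suc i) (subst (_≤ K st) (∸-unfold (K st) i i<K) (m∸n≤m (K st) i))))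
      inner′ : ∀ i → 1 ≤ i → i < K st → ∀ w → s st (K st ∸ i) ~ w →
               w ≡ s st (K st ∸ pred i) ⊎ w ≡ s st (K st ∸ suc i)
      inner′ (suc i) _ i+1<K w s~w with inner st (K st ∸ suc i) 1≤ (∸-monoʳ-< {o = 0} (s≤s z≤n) (<⇒≤ i+1<K)) w s~w
        where
        1≤ : 1 ≤ K st ∸ suc i
        1≤ = subst (1 ≤_) (sym (∸-unfold (K st) (suc i) i+1<K)) (s≤s z≤n)
      ... | inj₁ e = inj₂ (trans e (cong (s st) (pred[m∸n]≡m∸[1+n] (K st) (suc i))))
      ... | inj₂ e = inj₁ (trans e (cong (s st) (sym (∸-unfold (K st) i (≤-trans (n≤1+n (suc i)) i+1<K)))))

    Closed : Strand → Set
    Closed st = ∀ j → j ≤ K st → ∀ w → s st j ~ w → OnStrand st w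

    module ClosedStrand (st : Strand) (closed : Closed st) where

      everywhere : ∀ w → OnStrand st w
      everywhere w = along (proj₂ (conn (s st 0) w)) (0 , z≤n , refl)
        where
        along : ∀ {u w k} → Walk G u w k → OnStrand st u → OnStrand st w
        along here         on-u              = on-u
        along (step u~u′ p) (j , j≤K , refl) = along p (closed j j≤K _ u~u′)

      pos : V → ℕ
      pos w = proj₁ (everywhere w)

      pos≤K : ∀ w → pos w ≤ K st
      pos≤K w = proj₁ (proj₂ (everywhere w))

      at-pos : ∀ w → w ≡ s st (pos w)
      at-pos w = proj₂ (proj₂ (everywhere w))

      pos-at : ∀ j → j ≤ K st → pos (s st j) ≡ j
      pos-at j j≤K = distinct st (pos (s st j)) j (pos≤K (s st j)) j≤K (sym (at-pos (s st j)))

      pos-injective : ∀ {u w} → pos u ≡ pos w → u ≡ w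
      pos-injective {u} {w} e = trans (at-pos u) (trans (cong (s st) e) (sym (at-pos w)))

      index-lower-bound : (δ : ℕ → ℕ → ℕ) → (∀ j → δ j j ≡ 0) →
                          (∀ p q j → p ≤ K st → q ≤ K st → j ≤ K st → s st p ~ s st q → δ p j ≤ suc (δ q j)) →
                          ∀ i j → i ≤ K st → j ≤ K st → δ i j ≤ d (s st i) (s st j)
      index-lower-bound δ δ-diag δ-lip i j i≤K j≤K = subst (λ x → δ x j ≤ d (s st i) (s st j)) (pos-at i i≤K)
        (potential-bound (λ w → δ (pos w) j) (s st j) (trans (cong (λ x → δ x j) (pos-at j j≤K)) (δ-diag j))
          (λ u w u~w → δ-lip (pos u) (pos w) j (pos≤K u) (pos≤K w) j≤K (subst₂ _~_ (at-pos u) (at-pos w) u~w)) (s st i))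

      unique-nonresolver : (δ : ℕ → ℕ → ℕ) → (∀ i j → i ≤ K st → j ≤ K st → d (s st i) (s st j) ≡ δ i j) →
        (∀ c x y e → c ≤ K st → x ≤ K st → y ≤ K st → e ≤ K st → x ≢ y → δ c x ≡ δ c y → δ e x ≡ δ e y → c ≡ e) →
        ∀ x y → x ≢ y → ∀ a b → Equidistant x y a → Equidistant x y b → a ≡ b
      unique-nonresolver δ d≡δ unique x y x≢y a b a-eq b-eq =
        pos-injective (unique (pos a) (pos x) (pos y) (pos b) (pos≤K a) (pos≤K x) (pos≤K y) (pos≤K b)
                        (λ e → x≢y (pos-injective e)) (in-δ a a-eq) (in-δ b b-eq))
        where
        in-δ : ∀ c → Equidistant x y c → δ (pos c) (pos x) ≡ δ (pos c) (pos y)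
        in-δ c e = begin
          δ (pos c) (pos x)               ≡⟨ sym (d≡δ _ _ (pos≤K c) (pos≤K x)) ⟩
          d (s st (pos c)) (s st (pos x)) ≡⟨ cong₂ d (sym (at-pos c)) (sym (at-pos x)) ⟩
          d c x                           ≡⟨ e ⟩
          d c y                           ≡⟨ cong₂ d (at-pos c) (at-pos y) ⟩
          d (s st (pos c)) (s st (pos y)) ≡⟨ d≡δ _ _ (pos≤K c) (pos≤K y) ⟩
          δ (pos c) (pos y)               ∎
          where open ≡-Reasoning

    TailEnd : Strand → Set
    TailEnd st = ∀ w → s st (K st) ~ w → w ≡ s st (pred (K st))

    -- If both ends of a strand are ends of the graph, G is the path s 0, …, s K; there the distances
    -- are ∣ i - j ∣, and a pair of distinct vertices is not resolved only by its midpoint.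
    module PathGraph (st : Strand) (head-end : HeadEnd st) (tail-end : TailEnd st) where

      neighbour : ∀ j → j ≤ K st → ∀ w → s st j ~ w → ∃[ i ] i ≤ K st × w ≡ s st i × (i ≡ suc j ⊎ j ≡ suc i)
      neighbour zero _ w s0~w = 1 , ≤-trans (s≤s z≤n) (2≤K st) , head-end w s0~w , inj₁ refl
      neighbour (suc j) j<K w s~w with suc j ≟ K st
      ... | yes j+1≡K = j , ≤-trans (n≤1+n j) j<K ,
                        trans (tail-end w (subst (λ x → s st x ~ w) j+1≡K s~w)) (cong (λ x → s st (pred x)) (sym j+1≡K)) ,
                        inj₂ refl
      ... | no j+1≢K with inner st (suc j) (s≤s z≤n) (≤∧≢⇒< j<K j+1≢K) w s~w
      ...   | inj₁ e = j , ≤-trans (n≤1+n j) j<K , e , inj₂ refl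
      ...   | inj₂ e = suc (suc j) , ≤∧≢⇒< j<K j+1≢K , e , inj₁ refl

      closed : Closed st
      closed j j≤K w s~w with neighbour j j≤K w s~w
      ... | i , i≤K , e , _ = i , i≤K , e

      open ClosedStrand st closed

      distance : ∀ i j → i ≤ K st → j ≤ K st → d (s st i) (s st j) ≡ ∣ i - j ∣
      distance i j i≤K j≤K = ≤-antisym (path-short-∣∣ (K st) (s st) (path st) i j i≤K j≤K)
                                       (index-lower-bound ∣_-_∣ ∣n-n∣≡0 lip i j i≤K j≤K)
        where
        lip : ∀ p q j → p ≤ K st → q ≤ K st → j ≤ K st → s st p ~ s st q → ∣ p - j ∣ ≤ suc ∣ q - j ∣
        lip p q j p≤K q≤K _ sp~sq with neighbour p p≤K (s st q) sp~sq
        ... | i , i≤K , e , rel with distinct st q i q≤K i≤K e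
        ...   | refl with rel
        ...     | inj₁ refl = proj₁ (∣-∣-step p j)
        ...     | inj₂ refl = proj₂ (∣-∣-step q j)

      all-resolving : AllResolving G 2
      all-resolving = all-resolving-2 (unique-nonresolver ∣_-_∣ distance
        λ c x y e _ _ _ _ x≢y c-eq e-eq → double-injective c e
          (trans (equidistant⇒midpoint c x y c-eq x≢y) (sym (equidistant⇒midpoint e x y e-eq x≢y))))

    TailCycle : Strand → Set
    TailCycle st = ∀ w → s st (K st) ~ w → w ≡ s st (pred (K st)) ⊎ w ≡ s st 0

    CycleStep : ℕ → ℕ → ℕ → Set
    CycleStep K j i = i ≡ suc j ⊎ j ≡ suc i ⊎ (j ≡ 0 × i ≡ K) ⊎ (j ≡ K × i ≡ 0)

    module CycleGraph (st : Strand) (head-cycle : HeadCycle st) (tail-cycle : TailCycle st) where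

      L : ℕ
      L = suc (K st)

      neighbour : ∀ j → j ≤ K st → ∀ w → s st j ~ w → ∃[ i ] i ≤ K st × w ≡ s st i × CycleStep (K st) j i
      neighbour zero _ w s0~w with proj₂ head-cycle w s0~w
      ... | inj₁ e = 1 , ≤-trans (s≤s z≤n) (2≤K st) , e , inj₁ refl
      ... | inj₂ e = K st , ≤-refl , e , inj₂ (inj₂ (inj₁ (refl , refl)))
      neighbour (suc j) j<K w s~w with suc j ≟ K st
      ... | yes j+1≡K with tail-cycle w (subst (λ x → s st x ~ w) j+1≡K s~w)
      ...   | inj₁ e = j , ≤-trans (n≤1+n j) j<K , trans e (cong (λ x → s st (pred x)) (sym j+1≡K)) , inj₂ (inj₁ refl)
      ...   | inj₂ e = 0 , z≤n , e , inj₂ (inj₂ (inj₂ (j+1≡K , refl)))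
      neighbour (suc j) j<K w s~w | no j+1≢K with inner st (suc j) (s≤s z≤n) (≤∧≢⇒< j<K j+1≢K) w s~w
      ...   | inj₁ e = j , ≤-trans (n≤1+n j) j<K , e , inj₂ (inj₁ refl)
      ...   | inj₂ e = suc (suc j) , ≤∧≢⇒< j<K j+1≢K , e , inj₁ refl

      closed : Closed st
      closed j j≤K w s~w with neighbour j j≤K w s~w
      ... | i , i≤K , e , _ = i , i≤K , e

      open ClosedStrand st closed

      edge : ∀ p q → p ≤ K st → q ≤ K st → s st p ~ s st q → CycleStep (K st) p q
      edge p q p≤K q≤K sp~sq with neighbour p p≤K (s st q) sp~sq
      ... | i , i≤K , e , p→i with distinct st q i q≤K i≤K e
      ...   | refl = p→i

      around : ∀ i j → i ≤ j → j ≤ K st → d (s st i) (s st j) ≤ L ∸ ∣ i - j ∣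
      around i j i≤j j≤K with m≤n⇒∃[o]m+o≡n i≤j | m≤n⇒∃[o]m+o≡n j≤K
      ... | m , refl | r , i+m+r≡K = subst (d (s st i) (s st (i + m)) ≤_) (sym way-around) (begin
        d (s st i) (s st (i + m))                                                   ≤⟨ d-triangle _ (s st 0) _ ⟩
        d (s st i) (s st 0) + d (s st 0) (s st (i + m))                             ≤⟨ +-monoʳ-≤ _ (d-triangle _ (s st (K st)) _) ⟩
        d (s st i) (s st 0) + (d (s st 0) (s st (K st)) + d (s st (K st)) (s st (i + m))) ≤⟨ +-mono-≤ to-head
                                                                                    (+-mono-≤ (≤-reflexive (~⇒d≡1 (proj₁ head-cycle))) from-tail) ⟩
        i + suc r                                                                   ∎)
        where
        open ≤-Reasoning
        way-around : L ∸ ∣ i - (i + m) ∣ ≡ i + suc r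
        way-around = begin-equality
          L ∸ ∣ i - (i + m) ∣       ≡⟨ cong₂ _∸_ (cong suc (sym i+m+r≡K)) (∣m-m+n∣≡n i m) ⟩
          suc (i + m + r) ∸ m       ≡⟨ cong (_∸ m) (solve 3 (λ i m r → con 1 :+ ((i :+ m) :+ r) := m :+ (i :+ (con 1 :+ r))) refl i m r) ⟩
          m + (i + suc r) ∸ m       ≡⟨ m+n∸m≡n m (i + suc r) ⟩
          i + suc r                 ∎
        to-head : d (s st i) (s st 0) ≤ i
        to-head = subst (_≤ i) (d-sym (s st 0) (s st i)) (path-short (K st) (s st) (path st) 0 i (≤-trans (m≤m+n i m) j≤K))
        from-tail : d (s st (K st)) (s st (i + m)) ≤ r
        from-tail = subst (λ x → d (s st x) (s st (i + m)) ≤ r) i+m+r≡K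
                      (subst (_≤ r) (d-sym (s st (i + m)) (s st (i + m + r))) (path-short (K st) (s st) (path st) (i + m) r (≤-reflexive i+m+r≡K)))

      distance : ∀ i j → i ≤ K st → j ≤ K st → d (s st i) (s st j) ≡ cycDist L i j
      distance i j i≤K j≤K = ≤-antisym (⊓-glb (path-short-∣∣ (K st) (s st) (path st) i j i≤K j≤K) around′)
        (index-lower-bound (cycDist L) (λ j → cong (λ x → x ⊓ (L ∸ x)) (∣n-n∣≡0 j)) lip i j i≤K j≤K)
        where
        around′ : d (s st i) (s st j) ≤ L ∸ ∣ i - j ∣
        around′ with ≤-total i j
        ... | inj₁ i≤j = around i j i≤j j≤K
        ... | inj₂ j≤i = subst₂ (λ a b → a ≤ L ∸ b) (d-sym (s st j) (s st i)) (∣-∣-comm j i) (around j i j≤i i≤K)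
        lip : ∀ p q j → p ≤ K st → q ≤ K st → j ≤ K st → s st p ~ s st q → cycDist L p j ≤ suc (cycDist L q j)
        lip p q j p≤K q≤K j≤K sp~sq with edge p q p≤K q≤K sp~sq
        ... | inj₁ refl                   = proj₁ (cycDist-step L p j (s≤s q≤K) (s≤s j≤K))
        ... | inj₂ (inj₁ refl)            = proj₂ (cycDist-step L q j (s≤s p≤K) (s≤s j≤K))
        ... | inj₂ (inj₂ (inj₁ (refl , e))) = subst (λ x → cycDist L 0 j ≤ suc (cycDist L x j)) (sym e)
                                               (proj₂ (cycDist-wrap (K st) j j≤K))
        ... | inj₂ (inj₂ (inj₂ (e , e′))) = subst₂ (λ x y → cycDist L x j ≤ suc (cycDist L y j)) (sym e) (sym e′)
                                               (proj₁ (cycDist-wrap (K st) j j≤K))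

      odd-all-resolving : ∀ t → K st ≡ t + t → AllResolving G 2
      odd-all-resolving t K≡2t = all-resolving-2 (unique-nonresolver (cycDist L) distance
        λ c x y e c≤K x≤K y≤K e≤K x≢y c-eq e-eq →
          odd-cycle-resolving L t c e x y (cong suc K≡2t) (s≤s c≤K) (s≤s e≤K) (s≤s x≤K) (s≤s y≤K) x≢y c-eq e-eq)

      L≡n : L ≡ n
      L≡n = ≤-antisym (size-bound st) (injective⇒≤ {f = λ w → F.fromℕ< {m = pos w} {n = L} (s≤s (pos≤K w))}
        λ {u} {w} e → pos-injective (trans (sym (toℕ-fromℕ< (s≤s (pos≤K u)))) (trans (cong toℕ e) (toℕ-fromℕ< (s≤s (pos≤K w))))))

      position : V → Fin n
      position w = F.fromℕ< (≤-trans (s≤s (pos≤K w)) (size-bound st))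

      toℕ-position : ∀ w → toℕ (position w) ≡ pos w
      toℕ-position w = toℕ-fromℕ< _

      edge⇒consecutive : ∀ {u w} → u ~ w → Consecutive n (pos u) (pos w)
      edge⇒consecutive {u} {w} u~w with edge (pos u) (pos w) (pos≤K u) (pos≤K w) (subst₂ _~_ (at-pos u) (at-pos w) u~w)
      ... | inj₁ e                      = inj₁ (inj₁ (sym e))
      ... | inj₂ (inj₁ e)               = inj₂ (inj₁ (sym e))
      ... | inj₂ (inj₂ (inj₁ (e , e′))) = inj₂ (inj₂ (trans (cong suc e′) L≡n , e))
      ... | inj₂ (inj₂ (inj₂ (e , e′))) = inj₁ (inj₂ (trans (cong suc e) L≡n , e′))

      follows⇒edge : ∀ u w → Follows n (pos u) (pos w) → u ~ w
      follows⇒edge u w (inj₁ e) = subst₂ _~_ (sym (at-pos u)) (sym (at-pos w))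
        (subst (λ x → s st (pos u) ~ s st x) e (path st (pos u) (subst (_≤ K st) (sym e) (pos≤K w))))
      follows⇒edge u w (inj₂ (e , e′)) = subst₂ _~_ (sym (at-pos u)) (sym (at-pos w))
        (subst₂ (λ x y → s st x ~ s st y) (sym (suc-injective (trans e (sym L≡n)))) (sym e′) (~-sym (proj₁ head-cycle)))

      consecutive⇒edge : ∀ {u w} → Consecutive n (pos u) (pos w) → u ~ w
      consecutive⇒edge {u} {w} (inj₁ f) = follows⇒edge u w f
      consecutive⇒edge {u} {w} (inj₂ f) = ~-sym (follows⇒edge w u f)

      even-cycle : Even L → IsEvenCycle G
      even-cycle L-even = subst (3 ≤_) L≡n (s≤s (≤-trans 2≤D (D≤K st))) , subst Even L≡n L-even ,
        position , position-injective ,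
        λ u w → mk⇔
          (λ u~w → Equivalence.from (cycleAdj⇔consecutive n (position u) (position w))
                     (subst₂ (Consecutive n) (sym (toℕ-position u)) (sym (toℕ-position w)) (edge⇒consecutive u~w)))
          (λ adj → consecutive⇒edge (subst₂ (Consecutive n) (toℕ-position u) (toℕ-position w)
                     (Equivalence.to (cycleAdj⇔consecutive n (position u) (position w)) adj)))
        where
        position-injective : ∀ {u w} → position u ≡ position w → u ≡ w
        position-injective {u} {w} e = pos-injective (trans (sym (toℕ-position u)) (trans (cong toℕ e) (toℕ-position w)))

      result : IsEvenCycle G ⊎ AllResolving G 2
      result with even-or-odd (K st)
      ... | inj₁ K-even = inj₂ (odd-all-resolving (proj₁ (half K-even)) (proj₂ (half K-even)))
      ... | inj₂ L-even = inj₁ (even-cycle L-even)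

    Outcome : Set
    Outcome = ManyNonresolvers D ⊎ IsEvenCycle G ⊎ AllResolving G 2

    -- A head closing a cycle lies beyond the first geodesic, since d (s 0) (s K) = 1 < 2 ≤ D.
    cycle-long : ∀ st → HeadCycle st → D < K st
    cycle-long st head-cycle with m≤n⇒m<n∨m≡n (D≤K st)
    ... | inj₁ D<K = D<K
    ... | inj₂ D≡K = ⊥-elim (<-irrefl (sym D≡1) 2≤D)
      where
      D≡1 : D ≡ 1
      D≡1 = trans (sym (head-geodesic st 0 D z≤n ≤-refl))
                  (trans (cong (λ x → d (s st 0) (s st x)) D≡K) (~⇒d≡1 (proj₁ head-cycle)))

    -- When the head closes a cycle, a neighbour u of s K off the strand is adjacent to the inner vertex s K
    -- of the geodesic s (K ∸ 1), s K, s 0, …, s (D ∸ 2), obtained by prepending twice.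
    tail-third-neighbour : ∀ st → HeadCycle st → ∀ u → s st (K st) ~ u → ¬ OnStrand st u → ManyNonresolvers D
    tail-third-neighbour st head-cycle u sK~u u-off =
      OffGeodesicNeighbour.result D (s st (pred (K st)) ◂ s st (K st) ◂ s st) geo₂ u u-off′ 0 2≤D (~-sym sK~u)
      where
      D<K = cycle-long st head-cycle
      geo₁ : Geodesic D (s st (K st) ◂ s st)
      geo₁ = Prepend.prepend-geodesic D (s st) (head-geodesic st) (head-closed st) (s st (K st))
        (λ j j≤D e → <-irrefl refl (≤-trans D<K (subst (_≤ D) (sym (distinct st (K st) j ≤-refl (≤-trans j≤D (D≤K st)) e)) j≤D)))
        (~-sym (proj₁ head-cycle))
      closed₁ : InnerClosed D (s st (K st) ◂ s st)
      closed₁ (suc zero) _ _ w s0~w with proj₂ head-cycle w s0~w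
      ... | inj₁ e = 2 , 2≤D , e
      ... | inj₂ e = 0 , z≤n , e
      closed₁ (suc (suc i)) _ i+2<D w s~w with inner st (suc i) (s≤s z≤n) (≤-trans (≤-trans (n≤1+n _) i+2<D) (D≤K st)) w s~w
      ... | inj₁ e = suc i , ≤-trans (n≤1+n _) (<⇒≤ i+2<D) , e
      ... | inj₂ e = suc (suc (suc i)) , i+2<D , e
      geo₂ : Geodesic D (s st (pred (K st)) ◂ s st (K st) ◂ s st)
      geo₂ = Prepend.prepend-geodesic D (s st (K st) ◂ s st) geo₁ closed₁ (s st (pred (K st))) off
        (subst (λ x → s st (pred (K st)) ~ s st x) (suc-pred-K st) (path st (pred (K st)) (≤-reflexive (suc-pred-K st))))
        where
        off : ∀ j → j ≤ D → s st (pred (K st)) ≢ (s st (K st) ◂ s st) j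
        off zero    _   e = <-irrefl (distinct st (pred (K st)) (K st) (pred-K≤K st) ≤-refl e) (≤-reflexive (suc-pred-K st))
        off (suc j) j<D e = <-irrefl refl (≤-trans D<K (subst (_≤ D)
          (trans (cong suc (sym (distinct st (pred (K st)) j (pred-K≤K st) (≤-trans (≤-trans (n≤1+n j) j<D) (D≤K st)) e)))
                 (suc-pred-K st)) j<D))
      u-off′ : ∀ j → j ≤ D → u ≢ (s st (pred (K st)) ◂ s st (K st) ◂ s st) j
      u-off′ zero          _    = ¬within⇒off u-off (pred (K st)) (pred-K≤K st)
      u-off′ (suc zero)    _    = ¬within⇒off u-off (K st) ≤-refl
      u-off′ (suc (suc j)) j<D  = ¬within⇒off u-off j (≤-trans (≤-trans (n≤1+n j) (≤-trans (n≤1+n _) j<D)) (D≤K st))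

    from-cycle : ∀ st → HeadCycle st → Outcome
    from-cycle st head-cycle with any? (λ u → adj? (s st (K st)) u ×-dec ¬? (on? st u))
    ... | yes (u , sK~u , u-off) = inj₁ (tail-third-neighbour st head-cycle u sK~u u-off)
    ... | no none = inj₂ (CycleGraph.result st head-cycle tail-cycle)
      where
      tail-cycle : TailCycle st
      tail-cycle w sK~w = tail-neighbours st w sK~w (decidable-stable (on? st w) λ ¬on → none (w , sK~w , ¬on))

    from-tail-end : ∀ st → TailEnd st → Outcome
    from-tail-end st tail-end with grow-all st
    ... | found many = inj₁ many
    ... | end st′ (sK , sK-1) head-end = inj₂ (inj₂ (PathGraph.all-resolving st′ head-end tail-end′))
      where
      tail-end′ : TailEnd st′
      tail-end′ w s~w = trans (tail-end w (subst (_~ w) sK s~w)) (sym sK-1)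
    ... | cycle st′ (sK , sK-1) head-cycle = ⊥-elim (<-irrefl refl
      (subst (2 ≤_) (trans (sym (suc-pred-K st′)) (cong suc (sym 0≡K-1))) (2≤K st′)))
      where
      0≡K-1 : 0 ≡ pred (K st′)
      0≡K-1 = distinct st′ 0 (pred (K st′)) z≤n (pred-K≤K st′)
        (trans (tail-end (s st′ 0) (subst (_~ s st′ 0) sK (~-sym (proj₁ head-cycle)))) (sym sK-1))

    from-strand : Strand → Outcome
    from-strand st with grow-all st
    ... | found many          = inj₁ many
    ... | cycle st′ _ head-cycle = from-cycle st′ head-cycle
    ... | end st′ _ head-end  = from-tail-end (reverse-strand st′) tail-end
      where
      tail-end : TailEnd (reverse-strand st′)
      tail-end w s~w = trans (head-end w (subst (λ x → s st′ x ~ w) (n∸n≡0 (K st′)) s~w))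
                             (cong (s st′) (sym (K∸pred-K (K st′) (2≤K st′))))
        where
        K∸pred-K : ∀ k → 2 ≤ k → k ∸ pred k ≡ 1
        K∸pred-K (suc k) _ = m+n∸n≡m 1 k

    from-geodesic : (v : ℕ → V) → Geodesic D v → IsPath D v → Outcome
    from-geodesic v geo path
      with anyUpTo? (λ i → (1 ≤? i) ×-dec any? (λ w → adj? (v i) w ×-dec ¬? (within? D v w))) D
    ... | yes (suc a , a+1<D , _ , w , v~w , w-off) =
      inj₁ (OffGeodesicNeighbour.result D v geo w (¬within⇒off w-off) a a+1<D (~-sym v~w))
    ... | no none = from-strand initial
      where
      closed : InnerClosed D v
      closed i 1≤i i<D w v~w = decidable-stable (within? D v w) λ w-off → none (i , i<D , 1≤i , w , v~w , w-off)
      inner′ : ∀ i → 1 ≤ i → i < D → ∀ w → v i ~ w → w ≡ v (pred i) ⊎ w ≡ v (suc i)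
      inner′ i 1≤i i<D w v~w with closed i 1≤i i<D w v~w
      ... | j , j≤D , refl with geodesic-edge geo i j (<⇒≤ i<D) j≤D v~w
      ...   | inj₁ refl = inj₂ refl
      ...   | inj₂ refl = inj₁ refl
      initial : Strand
      initial = record
        { K = D ; s = v ; D≤K = ≤-refl ; distinct = geodesic-injective geo ; path = path ; inner = inner′
        ; head-geodesic = geo ; tail-geodesic = geodesic-cong (λ a _ → cong (λ x → v (x + a)) (sym (n∸n≡0 D))) geo }

  diameter-bound : ∀ D r → IsDiameter G D → IsResolvingNumber G r → 3 ≤ r → ¬ IsEvenCycle G → D + 5 ≤ 3 * r
  diameter-bound D r diam res 3≤r not-even with D ≤? 4
  ... | yes D≤4 = ≤-trans (+-monoˡ-≤ 5 D≤4) (*-monoʳ-≤ 3 3≤r)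
  ... | no D≰4 with proj₂ diam
  ...   | u , v , D-dist with shortest-path D u v (sym (isDist⇒≡d D-dist))
  ...     | p , p0≡u , pD≡v , path with Strands.from-geodesic D 2≤D p geo path
    where
    2≤D : 2 ≤ D
    2≤D = ≤-trans (s≤s (s≤s z≤n)) (≤-trans (n≤1+n _) (≰⇒> D≰4))
    geo : Geodesic D p
    geo = path-geodesic D p path (subst₂ (λ a b → d a b ≡ D) (sym p0≡u) (sym pD≡v) (sym (isDist⇒≡d D-dist)))
  ...       | inj₁ many            = many-nonresolvers-bound D r many (proj₁ res)
  ...       | inj₂ (inj₁ even)     = ⊥-elim (not-even even)
  ...       | inj₂ (inj₂ 2-resolv) = ⊥-elim (<-irrefl refl (≤-trans 3≤r (proj₂ res 2 2-resolv)))

-- Adjacency is decidable up to double negation, which suffices since the conclusion is decidable.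
proposition3p6 : (n : ℕ) (G : Graph n) (D r : ℕ) →
    Connected G → IsDiameter G D → IsResolvingNumber G r → 3 ≤ r →
    ¬ IsEvenCycle G →
    D + 5 ≤ 3 * r
proposition3p6 n G D r conn diam res 3≤r not-even =
  decidable-stable (D + 5 ≤? 3 * r) λ ¬bound →
    ¬¬-∀-Fin (λ u → ∀ v → Dec (Adj G u v)) (λ u → ¬¬-∀-Fin (λ v → Dec (Adj G u v)) (λ v → ¬¬-excluded-middle))
      λ adj? → ¬bound (WithDecidableAdjacency.diameter-bound G adj? conn D r diam res 3≤r not-even)
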